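{- For every even integer $k \geq 4$ and every odd integer $t \geq 3$, the graph $K_{k+1} \times K_t$ has a partial $C_{kt}$-factorization.
   Context: For graphs $G,H$, the tensor product $G \times H$ has vertex set $V(G)\times V(H)$, with $(g_1,h_1)$ adjacent to $(g_2,h_2)$ iff $g_1g_2 \in E(G)$ and $h_1h_2 \in E(H)$. $K_n$ is the complete graph on $n$ vertices. $K_{u} \times K_t$ is regarded as a $u$-partite graph with partite sets $V_i = \{i\}\times V(K_t)$. A partial $C_m$-factor of $K_u \times K_t$ is a subgraph which, for some $i$, is a spanning subgraph of $(K_u \times K_t)\setminus V_i$ all of whose components are cycles of length $m$; a partial $C_m$-factorization is a partition of the edge set into partial $C_m$-factors. -}

module Defs where

open import Data.Nat using (ℕ; zero; suc; _≥_)
open import Data.Nat.DivMod using (_mod_)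
open import Data.Fin using (Fin; toℕ)
open import Data.Product using (Σ; _×_; _,_; proj₁; ∃; ∃-syntax)
open import Data.Sum using (_⊎_)
open import Data.Empty using (⊥)
open import Relation.Nullary using (¬_)
open import Relation.Binary.PropositionalEquality using (_≡_; _≢_)
open import Function.Definitions using (Injective)

-- Vertices of K_u × K_t : pairs (i , a) with i ∈ Fin u (partite index), a ∈ Fin t.
Vertex : ℕ → ℕ → Set
Vertex u t = Fin u × Fin t

Adj : ∀ {u t} → Vertex u t → Vertex u t → Set
Adj (i , a) (j , b) = (i ≢ j) × (a ≢ b)

next : ∀ {m} → Fin m → Fin m
next {suc m} j = suc (toℕ j) mod (suc m)

record Cycle (u t m : ℕ) : Set where
  field
    len≥3  : m ≥ 3
    vert   : Fin m → Vertex u t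
    inj    : Injective _≡_ _≡_ vert
    adj    : ∀ j → Adj (vert j) (vert (next j))

CycleEdge : ∀ {u t m} → Cycle u t m → Vertex u t → Vertex u t → Set
CycleEdge {m = m} C x y =
  ∃[ j ] ((vert j ≡ x × vert (next j) ≡ y) ⊎ (vert j ≡ y × vert (next j) ≡ x))
  where open Cycle C

record PartialFactor (u t m : ℕ) : Set where
  field
    missing : Fin u
    ncycles : ℕ
    cycle   : Fin ncycles → Cycle u t m
    avoids  : ∀ c j → proj₁ (Cycle.vert (cycle c) j) ≢ missing
    covers  : ∀ (v : Vertex u t) → proj₁ v ≢ missing →
              Σ (Σ (Fin ncycles) (λ _ → Fin m)) λ p →
                (Cycle.vert (cycle (proj₁ p)) (Data.Product.proj₂ p) ≡ v) ×
                (∀ (q : Σ (Fin ncycles) (λ _ → Fin m)) →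
                   Cycle.vert (cycle (proj₁ q)) (Data.Product.proj₂ q) ≡ v → q ≡ p)

FactorEdge : ∀ {u t m} → PartialFactor u t m → Vertex u t → Vertex u t → Set
FactorEdge F x y = ∃[ c ] CycleEdge (PartialFactor.cycle F c) x y

-- A partial C_m-factorization: a family of partial C_m-factors such that every
-- edge of K_u × K_t lies in exactly one of them (edges of the factors are
-- edges of K_u × K_t by construction of Cycle).
record PartialFactorization (u t m : ℕ) : Set where
  field
    nfactors : ℕ
    factor   : Fin nfactors → PartialFactor u t m
    partition : ∀ (x y : Vertex u t) → Adj x y →
                Σ (Fin nfactors) λ f → FactorEdge (factor f) x y ×
                  (∀ g → FactorEdge (factor g) x y → g ≡ f)

-- Write k = 2m and t = 2h + 1.  The factor indexed by a part i of ℤ_{k+1} and s < h is a single closed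
-- walk of length kt that, at step p of lap l, visits (i + φ(p), A_s(p) + M·l).  The offsets φ(p) are
-- ±1, …, ±m, so the walk avoids exactly part i, and their cyclic differences Δ(p) are all nonzero
-- residues mod k + 1, with Δ(p*) = -Δ(p) for an opposite step p*.  The second-coordinate steps
-- A_s(p + 1) - A_s(p) of the h walks at p, together with the negated steps at p*, are all nonzero
-- residues mod t, and the drift M per lap is a unit mod t, so each walk is a cycle through all kt
-- vertices outside part i.  An edge (x, a)(y, b) then determines p or p* from y - x, s from b - a,
-- and i from x: it lies in exactly one factor.
module Submission where

open import Defs

open import Data.Bool.Base using (Bool; true; false; not; _xor_; if_then_else_; T)
open import Data.Bool.Properties using (not-involutive; not-injective; not-distribʳ-xor; xor-identityʳ; true-xor; xor-comm)
open import Data.Unit.Base using (tt)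
open import Data.Fin.Base as Fin using (Fin; toℕ; fromℕ<; punchOut)
import Data.Fin.Properties as Finₚ
open import Data.Integer.Base using (ℤ; +_; _+_; _-_; -_; _*_; _%ℕ_; _/ℕ_)
import Data.Integer.Properties as ℤₚ
open import Data.Integer.DivMod using (n%ℕd<d; a≡a%ℕn+[a/ℕn]*n)
open import Data.Integer.Divisibility.Signed using (_∣_; divides; ∣⇒∣ᵤ; ∣-refl; ∣m∣n⇒∣m+n; ∣m⇒∣-m; ∣n⇒∣m*n)
open import Data.Integer.Tactic.RingSolver using (solve-∀)
open import Data.Nat.Base as ℕ using (ℕ; zero; suc; NonZero; z≤n; s≤s; _∸_)
import Data.Nat.Properties as ℕₚ
import Data.Nat.Tactic.RingSolver as ℕSolver
import Data.Nat.DivMod as ℕDivMod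
import Data.Nat.Divisibility as ℕDiv
open import Data.Product using (Σ; ∃; _×_; _,_; proj₁; proj₂)
open import Data.Sum using (_⊎_; inj₁; inj₂)
open import Function.Base using (_∘_)
open import Function.Definitions using (Injective)
open import Relation.Binary.PropositionalEquality
open import Level using (0ℓ)
open import Relation.Binary.Bundles using (Setoid)
open import Relation.Binary.Definitions using (tri<; tri≈; tri>)
import Relation.Binary.Reasoning.Setoid as SetoidReasoning
open import Relation.Nullary using (¬_; yes; no; contradiction)

-- Congruences of integers

infix 4 _≡_mod_

-- A record rather than a synonym for divisibility, so that a and b can be inferred from the type.
record _≡_mod_ (a b : ℤ) (n : ℕ) : Set where
  constructor congruent
  field divides-difference : + n ∣ a - b

neg-difference : ∀ a b → - (a - b) ≡ b - a
neg-difference = solve-∀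

module _ {n : ℕ} where

  private
    rewrite-difference : ∀ {x y} → x ≡ y → + n ∣ x → + n ∣ y
    rewrite-difference = subst (+ n ∣_)

  ≡-mod-reflexive : ∀ {a b} → a ≡ b → a ≡ b mod n
  ≡-mod-reflexive {a} refl = congruent (rewrite-difference (sym (ℤₚ.+-inverseʳ a)) (∣n⇒∣m*n (+ 0) ∣-refl))

  ≡-mod-refl : ∀ {a} → a ≡ a mod n
  ≡-mod-refl = ≡-mod-reflexive refl

  ≡-mod-sym : ∀ {a b} → a ≡ b mod n → b ≡ a mod n
  ≡-mod-sym {a} {b} (congruent n∣a-b) = congruent (rewrite-difference (neg-difference a b) (∣m⇒∣-m n∣a-b))

  ≡-mod-trans : ∀ {a b c} → a ≡ b mod n → b ≡ c mod n → a ≡ c mod n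
  ≡-mod-trans {a} {b} {c} (congruent n∣a-b) (congruent n∣b-c) =
    congruent (rewrite-difference (telescope a b c) (∣m∣n⇒∣m+n n∣a-b n∣b-c))
    where
    telescope : ∀ a b c → (a - b) + (b - c) ≡ a - c
    telescope = solve-∀

  +-cong-mod : ∀ {a b c d} → a ≡ b mod n → c ≡ d mod n → a + c ≡ b + d mod n
  +-cong-mod {a} {b} {c} {d} (congruent n∣a-b) (congruent n∣c-d) =
    congruent (rewrite-difference (regroup a b c d) (∣m∣n⇒∣m+n n∣a-b n∣c-d))
    where
    regroup : ∀ a b c d → (a - b) + (c - d) ≡ (a + c) - (b + d)
    regroup = solve-∀

  neg-cong-mod : ∀ {a b} → a ≡ b mod n → - a ≡ - b mod n
  neg-cong-mod {a} {b} (congruent n∣a-b) = congruent (rewrite-difference (negate a b) (∣m⇒∣-m n∣a-b))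
    where
    negate : ∀ a b → - (a - b) ≡ - a - - b
    negate = solve-∀

  *-congˡ-mod : ∀ z {a b} → a ≡ b mod n → z * a ≡ z * b mod n
  *-congˡ-mod z {a} {b} (congruent n∣a-b) = congruent (rewrite-difference (distribute z a b) (∣n⇒∣m*n z n∣a-b))
    where
    distribute : ∀ z a b → z * (a - b) ≡ z * a - z * b
    distribute = solve-∀

  multiple≡0-mod : ∀ q → q * + n ≡ + 0 mod n
  multiple≡0-mod q = congruent (rewrite-difference (sym (ℤₚ.+-identityʳ (q * + n))) (∣n⇒∣m*n q ∣-refl))

  ≡-mod⇒-≡0 : ∀ {a b} → a ≡ b mod n → a - b ≡ + 0 mod n
  ≡-mod⇒-≡0 {a} {b} a≡b = ≡-mod-trans (+-cong-mod a≡b ≡-mod-refl) (≡-mod-reflexive (ℤₚ.+-inverseʳ b))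

  -≡0⇒≡-mod : ∀ {a b} → a - b ≡ + 0 mod n → a ≡ b mod n
  -≡0⇒≡-mod {a} {b} a-b≡0 =
    ≡-mod-trans (≡-mod-reflexive (restore a b)) (≡-mod-trans (+-cong-mod a-b≡0 ≡-mod-refl) (≡-mod-reflexive (ℤₚ.+-identityˡ b)))
    where
    restore : ∀ a b → a ≡ (a - b) + b
    restore = solve-∀

  +-cancelˡ-mod : ∀ x {a b} → x + a ≡ x + b mod n → a ≡ b mod n
  +-cancelˡ-mod x {a} {b} x+a≡x+b =
    ≡-mod-trans (≡-mod-reflexive (shift x a)) (≡-mod-trans (+-cong-mod (≡-mod-refl { - x}) x+a≡x+b) (≡-mod-reflexive (sym (shift x b))))
    where
    shift : ∀ x a → a ≡ - x + (x + a)
    shift = solve-∀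

  neg-cancel-mod : ∀ {a b} → - a ≡ - b mod n → a ≡ b mod n
  neg-cancel-mod {a} {b} -a≡-b = subst₂ (_≡_mod n) (ℤₚ.neg-involutive a) (ℤₚ.neg-involutive b) (neg-cong-mod -a≡-b)

  +-cancelʳ-mod : ∀ x {a b} → a + x ≡ b + x mod n → a ≡ b mod n
  +-cancelʳ-mod x {a} {b} a+x≡b+x = +-cancelˡ-mod x (subst₂ (_≡_mod n) (ℤₚ.+-comm a x) (ℤₚ.+-comm b x) a+x≡b+x)

  difference-cong-mod : ∀ {a b x y} → a ≡ x mod n → b ≡ y mod n → b - a ≡ y - x mod n
  difference-cong-mod a≡x b≡y = +-cong-mod b≡y (neg-cong-mod a≡x)

  +-difference-mod : ∀ {a d x y} → a ≡ x mod n → d ≡ y - x mod n → a + d ≡ y mod n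
  +-difference-mod {a} {d} {x} {y} a≡x d≡y-x =
    ≡-mod-trans (+-cong-mod a≡x d≡y-x) (≡-mod-reflexive (cancel x y))
    where
    cancel : ∀ x y → x + (y - x) ≡ y
    cancel = solve-∀

  +≡0-mod⇒≡neg : ∀ {a b} → a + b ≡ + 0 mod n → a ≡ - b mod n
  +≡0-mod⇒≡neg {a} {b} a+b≡0 = -≡0⇒≡-mod (≡-mod-trans (≡-mod-reflexive (rearrange a b)) a+b≡0)
    where
    rearrange : ∀ a b → a - - b ≡ a + b
    rearrange = solve-∀

  ≡neg-mod⇒+≡0 : ∀ {a b} → a ≡ - b mod n → a + b ≡ + 0 mod n
  ≡neg-mod⇒+≡0 {a} {b} a≡-b = ≡-mod-trans (+-cong-mod a≡-b ≡-mod-refl) (≡-mod-reflexive (ℤₚ.+-inverseˡ b))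

≡-mod-setoid : ℕ → Setoid 0ℓ 0ℓ
≡-mod-setoid n = record
  { Carrier       = ℤ
  ; _≈_           = λ a b → a ≡ b mod n
  ; isEquivalence = record { refl = ≡-mod-refl ; sym = ≡-mod-sym ; trans = ≡-mod-trans }
  }

module ≡-mod-Reasoning (n : ℕ) = SetoidReasoning (≡-mod-setoid n)

private
  below-modulus-not-divisible : ∀ {n d} → 0 ℕ.< d → d ℕ.< n → ¬ (+ n ∣ + d)
  below-modulus-not-divisible {d = suc d} _ d<n n∣d = ℕDiv.>⇒∤ d<n (∣⇒∣ᵤ n∣d)

  distinct-below-modulus : ∀ {n u v} → u ℕ.< v → v ℕ.< n → ¬ + v ≡ + u mod n
  distinct-below-modulus {n} {u} {v} u<v v<n (congruent n∣v-u) =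
    below-modulus-not-divisible (ℕₚ.m<n⇒0<n∸m u<v) (ℕₚ.≤-<-trans (ℕₚ.m∸n≤m v u) v<n)
      (subst (+ n ∣_) (trans (ℤₚ.m-n≡m⊖n v u) (ℤₚ.⊖-≥ (ℕₚ.<⇒≤ u<v))) n∣v-u)

≡-mod⇒≡ : ∀ {n u v} → u ℕ.< n → v ℕ.< n → + u ≡ + v mod n → u ≡ v
≡-mod⇒≡ {u = u} {v} u<n v<n u≡v with ℕₚ.<-cmp u v
... | tri< u<v _ _ = contradiction (≡-mod-sym u≡v) (distinct-below-modulus u<v v<n)
... | tri≈ _ u≡v _ = u≡v
... | tri> _ _ v<u = contradiction u≡v (distinct-below-modulus v<u u<n)

≡0-mod⇒≡0 : ∀ {n u} → u ℕ.< n → + u ≡ + 0 mod n → u ≡ 0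
≡0-mod⇒≡0 u<n = ≡-mod⇒≡ u<n (ℕₚ.≤-<-trans z≤n u<n)

module _ (n : ℕ) .{{_ : NonZero n}} where

  reduce : ℤ → Fin n
  reduce z = fromℕ< (n%ℕd<d z n)

  ≡-mod-reduce : ∀ z → z ≡ + toℕ (reduce z) mod n
  ≡-mod-reduce z = congruent (divides (z /ℕ n) (begin
    z - + toℕ (reduce z)            ≡⟨ cong (λ r → z - + r) (Finₚ.toℕ-fromℕ< (n%ℕd<d z n)) ⟩
    z - + (z %ℕ n)                  ≡⟨ cong (_- + (z %ℕ n)) (a≡a%ℕn+[a/ℕn]*n z n) ⟩
    + (z %ℕ n) + (z /ℕ n) * + n - + (z %ℕ n) ≡⟨ cancel (+ (z %ℕ n)) ((z /ℕ n) * + n) ⟩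
    (z /ℕ n) * + n                  ∎))
    where
    open ≡-Reasoning
    cancel : ∀ r m → r + m - r ≡ m
    cancel = solve-∀

  reduce-toℕ : ∀ x → reduce (+ toℕ x) ≡ x
  reduce-toℕ x = Finₚ.toℕ-injective (trans (Finₚ.toℕ-fromℕ< _) (ℕDivMod.m<n⇒m%n≡m (Finₚ.toℕ<n x)))

  reduce-cong : ∀ {a b} → a ≡ b mod n → reduce a ≡ reduce b
  reduce-cong {a} {b} a≡b = Finₚ.toℕ-injective (≡-mod⇒≡ (Finₚ.toℕ<n (reduce a)) (Finₚ.toℕ<n (reduce b))
    (≡-mod-trans (≡-mod-sym (≡-mod-reduce a)) (≡-mod-trans a≡b (≡-mod-reduce b))))

  reduce-injective : ∀ {a b} → reduce a ≡ reduce b → a ≡ b mod n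
  reduce-injective {a} {b} ra≡rb =
    ≡-mod-trans (≡-mod-reduce a) (≡-mod-trans (≡-mod-reflexive (cong (λ x → + toℕ x) ra≡rb)) (≡-mod-sym (≡-mod-reduce b)))

  reduce≡⇒≡-mod : ∀ {z x} → reduce z ≡ x → z ≡ + toℕ x mod n
  reduce≡⇒≡-mod {z} {x} refl = ≡-mod-reduce z

  ≡-mod⇒reduce≡ : ∀ {z x} → z ≡ + toℕ x mod n → reduce z ≡ x
  ≡-mod⇒reduce≡ {z} {x} z≡x = trans (reduce-cong z≡x) (reduce-toℕ x)

toℕ-≡-mod⇒≡ : ∀ {n} {i j : Fin n} → + toℕ i ≡ + toℕ j mod n → i ≡ j
toℕ-≡-mod⇒≡ {i = i} {j} i≡j = Finₚ.toℕ-injective (≡-mod⇒≡ (Finₚ.toℕ<n i) (Finₚ.toℕ<n j) i≡j)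

≢⇒difference≢0 : ∀ {n} {i j : Fin n} → i ≢ j → ¬ + toℕ j - + toℕ i ≡ + 0 mod n
≢⇒difference≢0 i≢j j-i≡0 = i≢j (sym (toℕ-≡-mod⇒≡ (-≡0⇒≡-mod j-i≡0)))

xor-true : ∀ c → c xor true ≡ not c
xor-true c = trans (xor-comm c true) (true-xor c)

xor-cancelˡ : ∀ a {b c} → a xor b ≡ a xor c → b ≡ c
xor-cancelˡ false eq = eq
xor-cancelˡ true  eq = not-injective eq

negateIf : Bool → ℤ → ℤ
negateIf false z = z
negateIf true  z = - z

neg-negateIf : ∀ c z → - negateIf c z ≡ negateIf (not c) z
neg-negateIf false z = refl
neg-negateIf true  z = ℤₚ.neg-involutive z

negateIf-xor : ∀ a c z → negateIf a (negateIf c z) ≡ negateIf (c xor a) z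
negateIf-xor false c z = cong (λ b → negateIf b z) (sym (xor-identityʳ c))
negateIf-xor true  c z = trans (neg-negateIf c z) (cong (λ b → negateIf b z) (sym (xor-true c)))

module _ {n : ℕ} where

  negateIf-cong-mod : ∀ c {a b} → a ≡ b mod n → negateIf c a ≡ negateIf c b mod n
  negateIf-cong-mod false a≡b = a≡b
  negateIf-cong-mod true  a≡b = neg-cong-mod a≡b

  negateIf-cancel-mod : ∀ c {a b} → negateIf c a ≡ negateIf c b mod n → a ≡ b mod n
  negateIf-cancel-mod false a≡b = a≡b
  negateIf-cancel-mod true  a≡b = neg-cancel-mod a≡b

  negateIf≡0-mod : ∀ c {a} → negateIf c a ≡ + 0 mod n → a ≡ + 0 mod n
  negateIf≡0-mod false a≡0 = a≡0
  negateIf≡0-mod true  a≡0 = neg-cancel-mod a≡0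

  private
    not-opposite : ∀ {x y} → 0 ℕ.< x → x ℕ.+ y ℕ.< n → ¬ + x ≡ - + y mod n
    not-opposite {x} {y} 0<x x+y<n x≡-y = ℕₚ.<⇒≢ (ℕₚ.<-≤-trans 0<x (ℕₚ.m≤m+n x y)) (sym (≡0-mod⇒≡0 x+y<n x+y≡0))
      where
      x+y≡0 : + (x ℕ.+ y) ≡ + 0 mod n
      x+y≡0 = ≡-mod-trans (≡-mod-reflexive (ℤₚ.pos-+ x y))
                (≡-mod-trans (+-cong-mod x≡-y ≡-mod-refl) (≡-mod-reflexive (ℤₚ.+-inverseˡ (+ y))))

  negateIf-injective-mod : ∀ {x y} c c′ → 0 ℕ.< x → 0 ℕ.< y → x ℕ.+ y ℕ.< n →
                           negateIf c (+ x) ≡ negateIf c′ (+ y) mod n → c ≡ c′ × x ≡ y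
  negateIf-injective-mod {x} {y} false false _ _ x+y<n x≡y =
    refl , ≡-mod⇒≡ (ℕₚ.≤-<-trans (ℕₚ.m≤m+n x y) x+y<n) (ℕₚ.≤-<-trans (ℕₚ.m≤n+m y x) x+y<n) x≡y
  negateIf-injective-mod {x} {y} true true _ _ x+y<n -x≡-y =
    refl , ≡-mod⇒≡ (ℕₚ.≤-<-trans (ℕₚ.m≤m+n x y) x+y<n) (ℕₚ.≤-<-trans (ℕₚ.m≤n+m y x) x+y<n) (neg-cancel-mod -x≡-y)
  negateIf-injective-mod false true 0<x _ x+y<n x≡-y = contradiction x≡-y (not-opposite 0<x x+y<n)
  negateIf-injective-mod {x} {y} true false _ 0<y x+y<n -x≡y =
    contradiction (≡-mod-sym -x≡y) (not-opposite 0<y (subst (ℕ._< n) (ℕₚ.+-comm x y) x+y<n))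

-- Finite sets and cyclic successors

injective⇒surjective : ∀ {n} (f : Fin n → Fin n) → Injective _≡_ _≡_ f → ∀ y → ∃ λ x → f x ≡ y
injective⇒surjective {suc n} f f-inj y with Finₚ.any? (λ x → f x Finₚ.≟ y)
... | yes hit = hit
... | no miss = contradiction (Finₚ.injective⇒≤ g-inj) (ℕₚ.<-irrefl refl)
  where
  y≢f : ∀ x → y ≢ f x
  y≢f x y≡fx = miss (x , sym y≡fx)
  g : Fin (suc n) → Fin n
  g x = punchOut (y≢f x)
  g-inj : Injective _≡_ _≡_ g
  g-inj gx≡gx′ = f-inj (Finₚ.punchOut-injective (y≢f _) (y≢f _) gx≡gx′)

injective-avoiding⇒surjective : ∀ {n} (f : Fin n → Fin (suc n)) (c : Fin (suc n)) →
  Injective _≡_ _≡_ f → (∀ x → f x ≢ c) → ∀ y → y ≢ c → ∃ λ x → f x ≡ y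
injective-avoiding⇒surjective f c f-inj f≢c y y≢c =
  let (x , gx≡y′) = injective⇒surjective g g-inj (punchOut (y≢c ∘ sym))
  in x , Finₚ.punchOut-injective (c≢f x) (y≢c ∘ sym) gx≡y′
  where
  c≢f : ∀ x → c ≢ f x
  c≢f x = f≢c x ∘ sym
  g : Fin _ → Fin _
  g x = punchOut (c≢f x)
  g-inj : Injective _≡_ _≡_ g
  g-inj gx≡gx′ = f-inj (Finₚ.punchOut-injective (c≢f _) (c≢f _) gx≡gx′)

toℕ-next : ∀ {n} (j : Fin (suc n)) → toℕ (next j) ≡ suc (toℕ j) ℕ.% suc n
toℕ-next j = Finₚ.toℕ-fromℕ< _

toℕ-next-< : ∀ {n} (j : Fin (suc n)) → suc (toℕ j) ℕ.< suc n → toℕ (next j) ≡ suc (toℕ j)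
toℕ-next-< j j+1<n = trans (toℕ-next j) (ℕDivMod.m<n⇒m%n≡m j+1<n)

toℕ-next-last : ∀ {n} (j : Fin (suc n)) → suc (toℕ j) ≡ suc n → toℕ (next j) ≡ 0
toℕ-next-last {n} j j+1≡n = trans (toℕ-next j) (trans (ℕDivMod.%-congˡ {o = suc n} j+1≡n) (ℕDivMod.n%n≡0 (suc n)))

next≢ : ∀ {n} (j : Fin (suc n)) → 1 ℕ.≤ n → next j ≢ j
next≢ j 1≤n next≡j with ℕₚ.m≤n⇒m<n∨m≡n (Finₚ.toℕ<n j)
... | inj₁ j+1<n = ℕₚ.1+n≢n (trans (sym (toℕ-next-< j j+1<n)) (cong toℕ next≡j))
... | inj₂ j+1≡n = ℕₚ.<⇒≢ 1≤n (trans (sym (toℕ-next-last j j+1≡n)) (trans (cong toℕ next≡j) (ℕₚ.suc-injective j+1≡n)))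

toℕ-next-≡-mod : ∀ {n} (j : Fin (suc n)) → + toℕ (next j) ≡ + suc (toℕ j) mod suc n
toℕ-next-≡-mod {n} j with ℕₚ.m≤n⇒m<n∨m≡n (Finₚ.toℕ<n j)
... | inj₁ j+1<n = ≡-mod-reflexive (cong +_ (toℕ-next-< j j+1<n))
... | inj₂ j+1≡n = ≡-mod-trans (≡-mod-reflexive (cong +_ (toℕ-next-last j j+1≡n)))
                     (≡-mod-sym (≡-mod-trans (≡-mod-reflexive (cong +_ j+1≡n))
                       (≡-mod-trans (≡-mod-reflexive (sym (ℤₚ.*-identityˡ (+ suc n)))) (multiple≡0-mod (+ 1)))))

-- Index j = k·l + p of a closed walk of length k·t is step p of lap l.
module Laps (k′ t′ : ℕ) where

  private
    k t : ℕ
    k = suc k′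
    t = suc t′

  at : Fin k → Fin t → Fin (k ℕ.* t)
  at p l = Fin.cast (ℕₚ.*-comm t k) (Fin.combine l p)

  position : Fin (k ℕ.* t) → Fin k
  position j = proj₂ (Fin.remQuot {t} k (Fin.cast (ℕₚ.*-comm k t) j))

  lap : Fin (k ℕ.* t) → Fin t
  lap j = proj₁ (Fin.remQuot {t} k (Fin.cast (ℕₚ.*-comm k t) j))

  toℕ-at : ∀ p l → toℕ (at p l) ≡ k ℕ.* toℕ l ℕ.+ toℕ p
  toℕ-at p l = trans (Finₚ.toℕ-cast _ (Fin.combine l p)) (Finₚ.toℕ-combine l p)

  at-position-lap : ∀ j → at (position j) (lap j) ≡ j
  at-position-lap j = trans (cong (Fin.cast _) (Finₚ.combine-remQuot {t} k (Fin.cast _ j)))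
                            (Finₚ.cast-involutive (ℕₚ.*-comm t k) (ℕₚ.*-comm k t) j)

  private
    decompose-at : ∀ p l → Fin.remQuot {t} k (Fin.cast (ℕₚ.*-comm k t) (at p l)) ≡ (l , p)
    decompose-at p l = trans (cong (Fin.remQuot {t} k) (Finₚ.cast-involutive (ℕₚ.*-comm k t) (ℕₚ.*-comm t k) (Fin.combine l p)))
                             (Finₚ.remQuot-combine l p)

  position-at : ∀ p l → position (at p l) ≡ p
  position-at p l = cong proj₂ (decompose-at p l)

  lap-at : ∀ p l → lap (at p l) ≡ l
  lap-at p l = cong proj₁ (decompose-at p l)

  next-at-within : ∀ p l → suc (toℕ p) ℕ.< k → next (at p l) ≡ at (next p) l
  next-at-within p l p+1<k = Finₚ.toℕ-injective (begin
    toℕ (next (at p l))          ≡⟨ toℕ-next-< (at p l) (subst (ℕ._< k ℕ.* t) (sym (cong suc (toℕ-at p l))) bound) ⟩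
    suc (toℕ (at p l))           ≡⟨ cong suc (toℕ-at p l) ⟩
    suc (k ℕ.* toℕ l ℕ.+ toℕ p)  ≡⟨ ℕₚ.+-suc (k ℕ.* toℕ l) (toℕ p) ⟨
    k ℕ.* toℕ l ℕ.+ suc (toℕ p)  ≡⟨ cong (k ℕ.* toℕ l ℕ.+_) (toℕ-next-< p p+1<k) ⟨
    k ℕ.* toℕ l ℕ.+ toℕ (next p) ≡⟨ toℕ-at (next p) l ⟨
    toℕ (at (next p) l)          ∎)
    where
    open ≡-Reasoning
    bound : suc (k ℕ.* toℕ l ℕ.+ toℕ p) ℕ.< k ℕ.* t
    bound = ℕₚ.≤-trans (s≤s (ℕₚ.≤-reflexive (sym (ℕₚ.+-suc (k ℕ.* toℕ l) (toℕ p)))))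
              (ℕₚ.≤-trans (ℕₚ.+-monoʳ-< (k ℕ.* toℕ l) p+1<k)
              (ℕₚ.≤-trans (ℕₚ.≤-reflexive (trans (ℕₚ.+-comm (k ℕ.* toℕ l) k) (sym (ℕₚ.*-suc k (toℕ l)))))
                (ℕₚ.*-monoʳ-≤ k (Finₚ.toℕ<n l))))

  next-at-across : ∀ p l → suc (toℕ p) ≡ k → next (at p l) ≡ at (next p) (next l)
  next-at-across p l p+1≡k = Finₚ.toℕ-injective (trans (lhs (ℕₚ.m≤n⇒m<n∨m≡n (Finₚ.toℕ<n l))) (sym rhs))
    where
    open ≡-Reasoning
    next-p≡0 : toℕ (next p) ≡ 0
    next-p≡0 = toℕ-next-last p p+1≡k
    end-of-lap : suc (toℕ (at p l)) ≡ k ℕ.* suc (toℕ l)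
    end-of-lap = begin
      suc (toℕ (at p l))           ≡⟨ cong suc (toℕ-at p l) ⟩
      suc (k ℕ.* toℕ l ℕ.+ toℕ p)  ≡⟨ ℕₚ.+-suc (k ℕ.* toℕ l) (toℕ p) ⟨
      k ℕ.* toℕ l ℕ.+ suc (toℕ p)  ≡⟨ cong (k ℕ.* toℕ l ℕ.+_) p+1≡k ⟩
      k ℕ.* toℕ l ℕ.+ k            ≡⟨ ℕₚ.+-comm (k ℕ.* toℕ l) k ⟩
      k ℕ.+ k ℕ.* toℕ l            ≡⟨ ℕₚ.*-suc k (toℕ l) ⟨
      k ℕ.* suc (toℕ l)            ∎
    rhs : toℕ (at (next p) (next l)) ≡ k ℕ.* toℕ (next l)
    rhs = trans (toℕ-at (next p) (next l)) (trans (cong (k ℕ.* toℕ (next l) ℕ.+_) next-p≡0) (ℕₚ.+-identityʳ _))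
    lhs : suc (toℕ l) ℕ.< t ⊎ suc (toℕ l) ≡ t → toℕ (next (at p l)) ≡ k ℕ.* toℕ (next l)
    lhs (inj₁ l+1<t) = begin
      toℕ (next (at p l))  ≡⟨ toℕ-next-< (at p l) (subst (ℕ._< k ℕ.* t) (sym end-of-lap) (ℕₚ.*-monoʳ-< k l+1<t)) ⟩
      suc (toℕ (at p l))   ≡⟨ end-of-lap ⟩
      k ℕ.* suc (toℕ l)    ≡⟨ cong (k ℕ.*_) (toℕ-next-< l l+1<t) ⟨
      k ℕ.* toℕ (next l)   ∎
    lhs (inj₂ l+1≡t) = begin
      toℕ (next (at p l))  ≡⟨ toℕ-next-last (at p l) (trans end-of-lap (cong (k ℕ.*_) l+1≡t)) ⟩
      0                    ≡⟨ ℕₚ.*-zeroʳ k ⟨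
      k ℕ.* 0              ≡⟨ cong (k ℕ.*_) (toℕ-next-last l l+1≡t) ⟨
      k ℕ.* toℕ (next l)   ∎

  next-within : ∀ j → suc (toℕ (position j)) ℕ.< k → next j ≡ at (next (position j)) (lap j)
  next-within j p+1<k = trans (cong next (sym (at-position-lap j))) (next-at-within (position j) (lap j) p+1<k)

  next-across : ∀ j → suc (toℕ (position j)) ≡ k → next j ≡ at (next (position j)) (next (lap j))
  next-across j p+1≡k = trans (cong next (sym (at-position-lap j))) (next-at-across (position j) (lap j) p+1≡k)

  position-next : ∀ j → position (next j) ≡ next (position j)
  position-next j with ℕₚ.m≤n⇒m<n∨m≡n (Finₚ.toℕ<n (position j))
  ... | inj₁ p+1<k = trans (cong position (next-within j p+1<k)) (position-at (next (position j)) (lap j))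
  ... | inj₂ p+1≡k = trans (cong position (next-across j p+1≡k)) (position-at (next (position j)) (next (lap j)))

  lap-next-within : ∀ j → suc (toℕ (position j)) ℕ.< k → lap (next j) ≡ lap j
  lap-next-within j p+1<k = trans (cong lap (next-within j p+1<k)) (lap-at (next (position j)) (lap j))

  lap-next-across : ∀ j → suc (toℕ (position j)) ≡ k → lap (next j) ≡ next (lap j)
  lap-next-across j p+1≡k = trans (cong lap (next-across j p+1≡k)) (lap-at (next (position j)) (next (lap j)))

-- Factorizations from a starter

differences : ∀ {k} → (Fin k → ℤ) → Fin k → ℤ
differences φ p = φ (next p) - φ p

-- The factor (i, s) of K_{k+1} × K_{2h+1} is the closed walk visiting (i + offset p, height s p + drift·l)
-- at step p of lap l.
record Starter (k h : ℕ) : Set where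
  field
    offset   : Fin k → ℤ
    opposite : Fin k → Fin k
    step     : Fin h → Fin k → ℤ
    height   : Fin h → Fin k → ℤ
    drift    : ℤ

    offset≢0             : ∀ p → ¬ offset p ≡ + 0 mod suc k
    offset-injective     : ∀ p p′ → offset p ≡ offset p′ mod suc k → p ≡ p′
    difference-injective : ∀ p p′ → differences offset p ≡ differences offset p′ mod suc k → p ≡ p′
    difference-opposite  : ∀ p → differences offset (opposite p) + differences offset p ≡ + 0 mod suc k

    step≢0               : ∀ s p → ¬ step s p ≡ + 0 mod suc (h ℕ.+ h)
    step-injective       : ∀ s s′ p → step s p ≡ step s′ p mod suc (h ℕ.+ h) → s ≡ s′
    step-opposite≢0      : ∀ s s′ p → ¬ step s p + step s′ (opposite p) ≡ + 0 mod suc (h ℕ.+ h)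
    height-next          : ∀ s p → suc (toℕ p) ℕ.< k →
                           height s (next p) ≡ height s p + step s p mod suc (h ℕ.+ h)
    height-wrap          : ∀ s p → suc (toℕ p) ≡ k →
                           height s (next p) + drift ≡ height s p + step s p mod suc (h ℕ.+ h)
    drift-invertible     : ∀ z → drift * z ≡ + 0 mod suc (h ℕ.+ h) → z ≡ + 0 mod suc (h ℕ.+ h)

module FromStarter {k′ h : ℕ} (starter : Starter (suc k′) h) (k≥3 : 3 ℕ.≤ suc k′) where

  open Starter starter
  open Laps k′ (h ℕ.+ h)

  k N t : ℕ
  k = suc k′
  N = suc k
  t = suc (h ℕ.+ h)

  Δ : Fin k → ℤ
  Δ = differences offset

  first : Fin N → Fin k → Fin N
  first i p = reduce N (+ toℕ i + offset p)

  levelAt : Fin h → Fin k → Fin t → ℤ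
  levelAt s p l = height s p + drift * + toℕ l

  level : Fin h → Fin (k ℕ.* t) → ℤ
  level s j = levelAt s (position j) (lap j)

  walk : Fin N → Fin h → Fin (k ℕ.* t) → Vertex N t
  walk i s j = first i (position j) , reduce t (level s j)

  level-next : ∀ s j → level s (next j) ≡ level s j + step s (position j) mod t
  level-next s j with ℕₚ.m≤n⇒m<n∨m≡n (Finₚ.toℕ<n (position j))
  ... | inj₁ p+1<k = begin
    level s (next j)
      ≡⟨ cong₂ (λ q m → height s q + drift * + toℕ m) (position-next j) (lap-next-within j p+1<k) ⟩
    height s (next p) + drift * + toℕ l
      ≈⟨ +-cong-mod (height-next s p p+1<k) ≡-mod-refl ⟩
    height s p + step s p + drift * + toℕ l
      ≡⟨ swap (height s p) (step s p) (drift * + toℕ l) ⟩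
    level s j + step s p
      ∎
    where
    open ≡-mod-Reasoning t
    p : Fin k
    p = position j
    l : Fin t
    l = lap j
    swap : ∀ a b c → a + b + c ≡ a + c + b
    swap = solve-∀
  ... | inj₂ p+1≡k = begin
    level s (next j)
      ≡⟨ cong₂ (λ q m → height s q + drift * + toℕ m) (position-next j) (lap-next-across j p+1≡k) ⟩
    height s (next p) + drift * + toℕ (next l)
      ≈⟨ +-cong-mod (≡-mod-refl {a = height s (next p)}) (*-congˡ-mod drift (toℕ-next-≡-mod l)) ⟩
    height s (next p) + drift * + suc (toℕ l)
      ≡⟨ regroup (height s (next p)) drift (+ toℕ l) ⟩
    height s (next p) + drift + drift * + toℕ l
      ≈⟨ +-cong-mod (height-wrap s p p+1≡k) ≡-mod-refl ⟩
    height s p + step s p + drift * + toℕ l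
      ≡⟨ swap (height s p) (step s p) (drift * + toℕ l) ⟩
    level s j + step s p
      ∎
    where
    open ≡-mod-Reasoning t
    p : Fin k
    p = position j
    l : Fin t
    l = lap j
    regroup : ∀ a d x → a + d * (+ 1 + x) ≡ a + d + d * x
    regroup = solve-∀
    swap : ∀ a b c → a + b + c ≡ a + c + b
    swap = solve-∀

  first-injective : ∀ i {p p′} → first i p ≡ first i p′ → p ≡ p′
  first-injective i eq = offset-injective _ _ (+-cancelˡ-mod (+ toℕ i) (reduce-injective N eq))

  first≢ : ∀ i p → first i p ≢ i
  first≢ i p first≡i = offset≢0 p (+-cancelˡ-mod (+ toℕ i)
    (≡-mod-trans (reduce≡⇒≡-mod N first≡i) (≡-mod-reflexive (sym (ℤₚ.+-identityʳ (+ toℕ i))))))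

  first-surjective : ∀ i x → x ≢ i → ∃ λ p → first i p ≡ x
  first-surjective i = injective-avoiding⇒surjective (first i) i (first-injective i) (first≢ i)

  levelAt-injective : ∀ s p {l l′} → reduce t (levelAt s p l) ≡ reduce t (levelAt s p l′) → l ≡ l′
  levelAt-injective s p {l} {l′} eq = Finₚ.toℕ-injective (≡-mod⇒≡ (Finₚ.toℕ<n l) (Finₚ.toℕ<n l′)
    (-≡0⇒≡-mod (drift-invertible _ (≡-mod-trans (≡-mod-reflexive (distribute drift (+ toℕ l) (+ toℕ l′)))
      (≡-mod⇒-≡0 (+-cancelˡ-mod (height s p) (reduce-injective t eq)))))))
    where
    distribute : ∀ d x y → d * (x - y) ≡ d * x - d * y
    distribute = solve-∀

  levelAt-surjective : ∀ s p a → ∃ λ l → reduce t (levelAt s p l) ≡ a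
  levelAt-surjective s p = injective⇒surjective (λ l → reduce t (levelAt s p l)) (levelAt-injective s p)

  walk-at : ∀ i s p l → walk i s (at p l) ≡ (first i p , reduce t (levelAt s p l))
  walk-at i s p l = cong₂ (λ q m → first i q , reduce t (levelAt s q m)) (position-at p l) (lap-at p l)

  walk-injective : ∀ i s → Injective _≡_ _≡_ (walk i s)
  walk-injective i s {j} {j′} eq = begin
    j                                ≡⟨ at-position-lap j ⟨
    at (position j) (lap j)          ≡⟨ cong₂ at same-position same-lap ⟩
    at (position j′) (lap j′)        ≡⟨ at-position-lap j′ ⟩
    j′                               ∎
    where
    open ≡-Reasoning
    same-position : position j ≡ position j′
    same-position = first-injective i (cong proj₁ eq)
    same-lap : lap j ≡ lap j′
    same-lap = levelAt-injective s (position j′)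
      (trans (cong (λ q → reduce t (levelAt s q (lap j))) (sym same-position)) (cong proj₂ eq))

  walk-adjacent : ∀ i s j → Adj (walk i s j) (walk i s (next j))
  walk-adjacent i s j = distinct-first , distinct-second
    where
    distinct-first : first i (position j) ≢ first i (position (next j))
    distinct-first eq = next≢ (position j) (ℕₚ.≤-pred (ℕₚ.≤-trans (s≤s (s≤s z≤n)) k≥3))
      (sym (trans (first-injective i eq) (position-next j)))
    distinct-second : reduce t (level s j) ≢ reduce t (level s (next j))
    distinct-second eq = step≢0 s (position j) (≡-mod-sym (+-cancelˡ-mod (level s j)
      (≡-mod-trans (≡-mod-reflexive (ℤₚ.+-identityʳ (level s j)))
        (≡-mod-trans (reduce-injective t eq) (level-next s j)))))

  cycle : Fin N → Fin h → Cycle N t (k ℕ.* t)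
  cycle i s = record
    { len≥3 = ℕₚ.≤-trans k≥3 (ℕₚ.m≤m*n k t)
    ; vert  = walk i s
    ; inj   = walk-injective i s
    ; adj   = walk-adjacent i s
    }

  walk-surjective : ∀ i s v → proj₁ v ≢ i → ∃ λ j → walk i s j ≡ v
  walk-surjective i s (x , a) x≢i =
    let (p , first≡x) = first-surjective i x x≢i
        (l , level≡a) = levelAt-surjective s p a
    in at p l , trans (walk-at i s p l) (cong₂ _,_ first≡x level≡a)

  cycleFactor : Fin N → Fin h → PartialFactor N t (k ℕ.* t)
  cycleFactor i s = record
    { missing = i
    ; ncycles = 1
    ; cycle   = λ _ → cycle i s
    ; avoids  = λ _ j → first≢ i (position j)
    ; covers  = λ v v≢i → let (j , walk≡v) = walk-surjective i s v v≢i in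
        (Fin.zero , j) , walk≡v ,
        λ { (Fin.zero , j′) walk≡v′ → cong (Fin.zero ,_) (walk-injective i s (trans walk≡v′ (sym walk≡v))) }
    }

  record Traverses (i : Fin N) (s : Fin h) (p : Fin k) (x y : Vertex N t) : Set where
    field
      starts-at   : + toℕ i + offset p ≡ + toℕ (proj₁ x) mod N
      first-diff  : Δ p ≡ + toℕ (proj₁ y) - + toℕ (proj₁ x) mod N
      second-diff : step s p ≡ + toℕ (proj₂ y) - + toℕ (proj₂ x) mod t

  open Traverses

  Uses : Fin N → Fin h → Vertex N t → Vertex N t → Set
  Uses i s x y = (∃ λ p → Traverses i s p x y) ⊎ (∃ λ p → Traverses i s p y x)

  walk-first : ∀ {i s x} j → walk i s j ≡ x → + toℕ i + offset (position j) ≡ + toℕ (proj₁ x) mod N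
  walk-first {i} j walk≡x = reduce≡⇒≡-mod N {z = + toℕ i + offset (position j)} (cong proj₁ walk≡x)

  walk-second : ∀ {i s x} j → walk i s j ≡ x → level s j ≡ + toℕ (proj₂ x) mod t
  walk-second {s = s} j walk≡x = reduce≡⇒≡-mod t {z = level s j} (cong proj₂ walk≡x)

  walk⇒traverses : ∀ {i s x y} j → walk i s j ≡ x → walk i s (next j) ≡ y → Traverses i s (position j) x y
  walk⇒traverses {i} {s} {x} {y} j walk≡x walk′≡y = record
    { starts-at   = walk-first j walk≡x
    ; first-diff  = ≡-mod-trans (≡-mod-reflexive (sym (shift (+ toℕ i) (offset p) (offset (next p)))))
                      (difference-cong-mod (walk-first j walk≡x) next-first)
    ; second-diff = ≡-mod-trans (≡-mod-reflexive (sym (cancel (level s j) (step s p))))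
                      (difference-cong-mod (walk-second j walk≡x)
                        (≡-mod-trans (≡-mod-sym (level-next s j)) (walk-second (next j) walk′≡y)))
    }
    where
    p : Fin k
    p = position j
    next-first : + toℕ i + offset (next p) ≡ + toℕ (proj₁ y) mod N
    next-first = ≡-mod-trans (≡-mod-reflexive (cong (λ q → + toℕ i + offset q) (sym (position-next j))))
      (walk-first (next j) walk′≡y)
    shift : ∀ a b c → (a + c) - (a + b) ≡ c - b
    shift = solve-∀
    cancel : ∀ a b → (a + b) - a ≡ b
    cancel = solve-∀

  walk-starting : ∀ i s p x → + toℕ i + offset p ≡ + toℕ (proj₁ x) mod N → ∃ λ j → position j ≡ p × walk i s j ≡ x
  walk-starting i s p (x , a) starts-at =
    let (l , level≡a) = levelAt-surjective s p a
    in at p l , position-at p l , trans (walk-at i s p l) (cong₂ _,_ (≡-mod⇒reduce≡ N starts-at) level≡a)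

  walk-continues : ∀ {i s p x y} j → position j ≡ p → walk i s j ≡ x → Traverses i s p x y → walk i s (next j) ≡ y
  walk-continues {i} {s} {p} {x} {y} j refl walk≡x T = cong₂ _,_ first≡ second≡
    where
    first≡ : first i (position (next j)) ≡ proj₁ y
    first≡ = ≡-mod⇒reduce≡ N (≡-mod-trans (≡-mod-reflexive (cong (λ q → + toℕ i + offset q) (position-next j)))
      (≡-mod-trans (≡-mod-reflexive (regroup (+ toℕ i) (offset p) (offset (next p)))) (+-difference-mod (starts-at T) (first-diff T))))
      where
      regroup : ∀ a b c → a + c ≡ (a + b) + (c - b)
      regroup = solve-∀
    second≡ : reduce t (level s (next j)) ≡ proj₂ y
    second≡ = ≡-mod⇒reduce≡ t (≡-mod-trans (level-next s j)
      (+-difference-mod (walk-second j walk≡x) (second-diff T)))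

  Δ-opposite : ∀ p → Δ (opposite p) ≡ - Δ p mod N
  Δ-opposite p = +≡0-mod⇒≡neg (difference-opposite p)

  traverses-unique : ∀ {i i′ s s′ p p′ x y} → Traverses i s p x y → Traverses i′ s′ p′ x y → i ≡ i′ × s ≡ s′
  traverses-unique {i} {s = s} {p = p} {p′} {x} {y} T T′ =
    unique-at (difference-injective p p′ (≡-mod-trans (first-diff T) (≡-mod-sym (first-diff T′)))) T′
    where
    unique-at : ∀ {i′ s′ p′} → p ≡ p′ → Traverses i′ s′ p′ x y → i ≡ i′ × s ≡ s′
    unique-at {s′ = s′} refl T′ =
      toℕ-≡-mod⇒≡ (+-cancelʳ-mod (offset p) (≡-mod-trans (starts-at T) (≡-mod-sym (starts-at T′)))) ,
      step-injective s s′ p (≡-mod-trans (second-diff T) (≡-mod-sym (second-diff T′)))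

  reversed-at-opposite : ∀ {i i′ s s′ p p′ x y} → Traverses i s p x y → Traverses i′ s′ p′ y x → opposite p ≡ p′
  reversed-at-opposite {p = p} {p′} {x} {y} T T′ = difference-injective (opposite p) p′
    (≡-mod-trans (Δ-opposite p) (≡-mod-trans (neg-cong-mod (first-diff T))
      (≡-mod-trans (≡-mod-reflexive (neg-difference (+ toℕ (proj₁ y)) (+ toℕ (proj₁ x)))) (≡-mod-sym (first-diff T′)))))

  traverses-one-way : ∀ {i i′ s s′ p p′ x y} → Traverses i s p x y → ¬ Traverses i′ s′ p′ y x
  traverses-one-way {s = s} {p = p} {x = x} {y} T T′ = opposite-steps (reversed-at-opposite T T′) T′
    where
    cancel : ∀ a b → (a - b) + (b - a) ≡ + 0
    cancel = solve-∀
    opposite-steps : ∀ {i′ s′ p′} → opposite p ≡ p′ → ¬ Traverses i′ s′ p′ y x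
    opposite-steps {s′ = s′} refl T′ = step-opposite≢0 s s′ p (≡-mod-trans (+-cong-mod (second-diff T) (second-diff T′))
      (≡-mod-reflexive (cancel (+ toℕ (proj₂ y)) (+ toℕ (proj₂ x)))))

  difference-surjective : ∀ d → ¬ d ≡ + 0 mod N → ∃ λ p → Δ p ≡ d mod N
  difference-surjective d d≢0 =
    let (p , Δp≡d) = injective-avoiding⇒surjective (reduce N ∘ Δ) Fin.zero
                       (λ eq → difference-injective _ _ (reduce-injective N eq)) Δ≢0 (reduce N d) (d≢0 ∘ reduce≡⇒≡-mod N)
    in p , reduce-injective N Δp≡d
    where
    Δ≢0 : ∀ p → reduce N (Δ p) ≢ Fin.zero
    Δ≢0 p Δp≡0 = next≢ p (ℕₚ.≤-pred (ℕₚ.≤-trans (s≤s (s≤s z≤n)) k≥3))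
      (offset-injective _ _ (-≡0⇒≡-mod (reduce≡⇒≡-mod N Δp≡0)))

  -- The 2h values step s p and - step s (opposite p) are distinct and nonzero mod t = 2h + 1, hence they
  -- are all the nonzero residues.
  private
    choice : Fin k → Fin h ⊎ Fin h → ℤ
    choice p (inj₁ s) = step s p
    choice p (inj₂ s) = - step s (opposite p)

    choice-injective : ∀ p {u u′} → choice p u ≡ choice p u′ mod t → u ≡ u′
    choice-injective p {inj₁ s} {inj₁ s′} eq = cong inj₁ (step-injective s s′ p eq)
    choice-injective p {inj₂ s} {inj₂ s′} eq = cong inj₂ (step-injective s s′ (opposite p) (neg-cancel-mod eq))
    choice-injective p {inj₁ s} {inj₂ s′} eq = contradiction (≡neg-mod⇒+≡0 eq) (step-opposite≢0 s s′ p)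
    choice-injective p {inj₂ s} {inj₁ s′} eq = contradiction (≡neg-mod⇒+≡0 (≡-mod-sym eq)) (step-opposite≢0 s′ s p)

    choice≢0 : ∀ p u → ¬ choice p u ≡ + 0 mod t
    choice≢0 p (inj₁ s) = step≢0 s p
    choice≢0 p (inj₂ s) = step≢0 s (opposite p) ∘ neg-cancel-mod

    choices : Fin k → Fin (h ℕ.+ h) → Fin t
    choices p e = reduce t (choice p (Fin.splitAt h e))

    choices-injective : ∀ p → Injective _≡_ _≡_ (choices p)
    choices-injective p {e} {e′} eq = begin
      e
        ≡⟨ Finₚ.join-splitAt h h e ⟨
      Fin.join h h (Fin.splitAt h e)
        ≡⟨ cong (Fin.join h h) (choice-injective p {Fin.splitAt h e} {Fin.splitAt h e′} (reduce-injective t eq)) ⟩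
      Fin.join h h (Fin.splitAt h e′)
        ≡⟨ Finₚ.join-splitAt h h e′ ⟩
      e′
        ∎
      where open ≡-Reasoning

    choices≢0 : ∀ p e → choices p e ≢ Fin.zero
    choices≢0 p e = choice≢0 p (Fin.splitAt h e) ∘ reduce≡⇒≡-mod t

  step-choices : ∀ p δ → ¬ δ ≡ + 0 mod t → (∃ λ s → step s p ≡ δ mod t) ⊎ (∃ λ s → step s (opposite p) ≡ - δ mod t)
  step-choices p δ δ≢0 =
    let (e , choice≡δ) = injective-avoiding⇒surjective (choices p) Fin.zero (choices-injective p) (choices≢0 p)
                           (reduce t δ) (δ≢0 ∘ reduce≡⇒≡-mod t)
    in from-choice (Fin.splitAt h e) (reduce-injective t choice≡δ)
    where
    from-choice : ∀ u → choice p u ≡ δ mod t → (∃ λ s → step s p ≡ δ mod t) ⊎ (∃ λ s → step s (opposite p) ≡ - δ mod t)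
    from-choice (inj₁ s) eq = inj₁ (s , eq)
    from-choice (inj₂ s) eq = inj₂ (s , subst (_≡ - δ mod t) (ℤₚ.neg-involutive (step s (opposite p))) (neg-cong-mod eq))

  traverses-from : ∀ {s p x y} → Δ p ≡ + toℕ (proj₁ y) - + toℕ (proj₁ x) mod N →
                   step s p ≡ + toℕ (proj₂ y) - + toℕ (proj₂ x) mod t →
                   Traverses (reduce N (+ toℕ (proj₁ x) - offset p)) s p x y
  traverses-from {p = p} {x} Δp≡ step≡ = record
    { starts-at   = ≡-mod-trans (+-cong-mod (≡-mod-sym (≡-mod-reduce N (+ toℕ (proj₁ x) - offset p))) ≡-mod-refl)
                      (≡-mod-reflexive (cancel (+ toℕ (proj₁ x)) (offset p)))
    ; first-diff  = Δp≡
    ; second-diff = step≡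
    }
    where
    cancel : ∀ a b → a - b + b ≡ a
    cancel = solve-∀

  used-from-choice : ∀ {x y p} → Δ p ≡ + toℕ (proj₁ y) - + toℕ (proj₁ x) mod N →
    (∃ λ s → step s p ≡ + toℕ (proj₂ y) - + toℕ (proj₂ x) mod t) ⊎
    (∃ λ s → step s (opposite p) ≡ - (+ toℕ (proj₂ y) - + toℕ (proj₂ x)) mod t) →
    ∃ λ i → ∃ λ s → Uses i s x y
  used-from-choice {x} {y} {p} Δp≡y-x (inj₁ (s , step≡b-a)) = _ , s , inj₁ (p , traverses-from {s} {p} {x} {y} Δp≡y-x step≡b-a)
  used-from-choice {x} {y} {p} Δp≡y-x (inj₂ (s , step≡a-b)) = _ , s , inj₂ (opposite p , traverses-from {s} {opposite p} {y} {x}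
    (≡-mod-trans (Δ-opposite p) (≡-mod-trans (neg-cong-mod Δp≡y-x) (≡-mod-reflexive (neg-difference (+ toℕ (proj₁ y)) (+ toℕ (proj₁ x))))))
    (≡-mod-trans step≡a-b (≡-mod-reflexive (neg-difference (+ toℕ (proj₂ y)) (+ toℕ (proj₂ x))))))

  adjacent⇒used : ∀ {x y} → Adj x y → ∃ λ i → ∃ λ s → Uses i s x y
  adjacent⇒used {x₁ , a} {y₁ , b} (x≢y , a≢b) =
    let (p , Δp≡y-x) = difference-surjective (+ toℕ y₁ - + toℕ x₁) (≢⇒difference≢0 x≢y)
    in used-from-choice Δp≡y-x (step-choices p (+ toℕ b - + toℕ a) (≢⇒difference≢0 a≢b))

  cycleEdge⇒used : ∀ {i s x y} → CycleEdge (cycle i s) x y → Uses i s x y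
  cycleEdge⇒used (j , inj₁ (walk≡x , walk′≡y)) = inj₁ (position j , walk⇒traverses j walk≡x walk′≡y)
  cycleEdge⇒used (j , inj₂ (walk≡y , walk′≡x)) = inj₂ (position j , walk⇒traverses j walk≡y walk′≡x)

  traverses⇒walk : ∀ {i s p x y} → Traverses i s p x y → ∃ λ j → walk i s j ≡ x × walk i s (next j) ≡ y
  traverses⇒walk {i} {s} {p} {x} T =
    let (j , position≡p , walk≡x) = walk-starting i s p x (starts-at T)
    in j , walk≡x , walk-continues j position≡p walk≡x T

  used⇒cycleEdge : ∀ {i s x y} → Uses i s x y → CycleEdge (cycle i s) x y
  used⇒cycleEdge (inj₁ (_ , T)) = let (j , walk≡x , walk′≡y) = traverses⇒walk T in j , inj₁ (walk≡x , walk′≡y)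
  used⇒cycleEdge (inj₂ (_ , T)) = let (j , walk≡y , walk′≡x) = traverses⇒walk T in j , inj₂ (walk≡y , walk′≡x)

  used-unique : ∀ {i i′ s s′ x y} → Uses i s x y → Uses i′ s′ x y → i ≡ i′ × s ≡ s′
  used-unique (inj₁ (_ , T)) (inj₁ (_ , T′)) = traverses-unique T T′
  used-unique (inj₂ (_ , T)) (inj₂ (_ , T′)) = traverses-unique T T′
  used-unique (inj₁ (_ , T)) (inj₂ (_ , T′)) = contradiction T′ (traverses-one-way T)
  used-unique (inj₂ (_ , T)) (inj₁ (_ , T′)) = contradiction T (traverses-one-way T′)

  factor : Fin (N ℕ.* h) → PartialFactor N t (k ℕ.* t)
  factor f = cycleFactor (proj₁ (Fin.remQuot {N} h f)) (proj₂ (Fin.remQuot {N} h f))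

  factorization : PartialFactorization N t (k ℕ.* t)
  factorization = record { nfactors = N ℕ.* h ; factor = factor ; partition = partition }
    where
    partition : ∀ x y → Adj x y → Σ (Fin (N ℕ.* h)) λ f → FactorEdge (factor f) x y × (∀ g → FactorEdge (factor g) x y → g ≡ f)
    partition x y x~y = from-used (adjacent⇒used x~y)
      where
      from-used : (∃ λ i → ∃ λ s → Uses i s x y) →
                  Σ (Fin (N ℕ.* h)) λ f → FactorEdge (factor f) x y × (∀ g → FactorEdge (factor g) x y → g ≡ f)
      from-used (i , s , used) =
        Fin.combine i s ,
        (Fin.zero , subst (λ (i , s) → CycleEdge (cycle i s) x y) (sym (Finₚ.remQuot-combine i s)) (used⇒cycleEdge used)) ,
        λ g (_ , edge) → let (i≡ , s≡) = used-unique (cycleEdge⇒used edge) used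
                          in trans (sym (Finₚ.combine-remQuot {N} h g)) (cong₂ Fin.combine i≡ s≡)

-- An explicit starter

<ᵇ-view : ∀ m n → (m ℕ.< n × (m ℕ.<ᵇ n) ≡ true) ⊎ (n ℕ.≤ m × (m ℕ.<ᵇ n) ≡ false)
<ᵇ-view m n with m ℕ.<ᵇ n in eq
... | true  = inj₁ (ℕₚ.<ᵇ⇒< m n (subst T (sym eq) tt) , refl)
... | false = inj₂ (ℕₚ.≮⇒≥ (λ m<n → subst T eq (ℕₚ.<⇒<ᵇ m<n)) , refl)

<ᵇ-true : ∀ {m n} → m ℕ.< n → (m ℕ.<ᵇ n) ≡ true
<ᵇ-true {m} {n} m<n with <ᵇ-view m n
... | inj₁ (_ , eq)    = eq
... | inj₂ (n≤m , _)   = contradiction n≤m (ℕₚ.<⇒≱ m<n)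

<ᵇ-false : ∀ {m n} → n ℕ.≤ m → (m ℕ.<ᵇ n) ≡ false
<ᵇ-false {m} {n} n≤m with <ᵇ-view m n
... | inj₁ (m<n , _)   = contradiction n≤m (ℕₚ.<⇒≱ m<n)
... | inj₂ (_ , eq)    = eq

odd : ℕ → Bool
odd zero    = false
odd (suc n) = not (odd n)

odd-double+ : ∀ a c → odd (a ℕ.+ a ℕ.+ c) ≡ odd c
odd-double+ zero    c = refl
odd-double+ (suc a) c rewrite ℕₚ.+-suc a a = trans (not-involutive (odd (a ℕ.+ a ℕ.+ c))) (odd-double+ a c)

odd≢double : ∀ a b → suc (a ℕ.+ a) ≢ b ℕ.+ b
odd≢double zero    (suc b) eq = ℕₚ.0≢1+n (trans (ℕₚ.suc-injective eq) (ℕₚ.+-suc b b))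
odd≢double (suc a) (suc b) eq =
  odd≢double a b (ℕₚ.suc-injective (trans (sym (cong suc (ℕₚ.+-suc a a))) (trans (ℕₚ.suc-injective eq) (ℕₚ.+-suc b b))))

double-injective : ∀ a b → a ℕ.+ a ≡ b ℕ.+ b → a ≡ b
double-injective zero    zero    eq = refl
double-injective zero    (suc b) eq = contradiction eq ℕₚ.0≢1+n
double-injective (suc a) (suc b) eq =
  cong suc (double-injective a b (ℕₚ.suc-injective (trans (sym (ℕₚ.+-suc a a)) (trans (ℕₚ.suc-injective eq) (ℕₚ.+-suc b b)))))

closing-jump : ∀ q b → b ℕ.≤ 1 → let S = q ℕ.+ q ℕ.+ b in
  - + 1 - negateIf (not (odd b)) (+ suc S) ≡ + ((q ℕ.+ b) ℕ.+ (q ℕ.+ b)) mod suc (suc S ℕ.+ suc S)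
closing-jump q zero _ = ≡-mod-reflexive (trans (jump (+ q)) (cong (λ z → + (z ℕ.+ z)) (sym (ℕₚ.+-identityʳ q))))
  where
  jump : ∀ x → - + 1 - - (+ 1 + ((x + x) + + 0)) ≡ x + x
  jump = solve-∀
closing-jump q (suc zero) _ = congruent (divides (- + 1) (jump (+ q)))
  where
  jump : ∀ x → (- + 1 - (+ 1 + ((x + x) + + 1))) - ((x + + 1) + (x + + 1))
               ≡ - + 1 * (+ 1 + (+ 1 + (((x + x) + + 1) + (+ 1 + ((x + x) + + 1)))))
  jump = solve-∀
closing-jump q (suc (suc _)) (s≤s ())

two-invertible-mod-odd : ∀ h z → + 2 * z ≡ + 0 mod suc (h ℕ.+ h) → z ≡ + 0 mod suc (h ℕ.+ h)
two-invertible-mod-odd h z 2z≡0 = begin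
  z                    ≈⟨ congruent (divides (- z) (halve z (+ h))) ⟩
  + suc h * (+ 2 * z)  ≈⟨ *-congˡ-mod (+ suc h) 2z≡0 ⟩
  + suc h * + 0        ≡⟨ ℤₚ.*-zeroʳ (+ suc h) ⟩
  + 0                  ∎
  where
  open ≡-mod-Reasoning (suc (h ℕ.+ h))
  halve : ∀ z x → z - (+ 1 + x) * (+ 2 * z) ≡ - z * (+ 1 + (x + x))
  halve = solve-∀

one-or-two-invertible-mod-odd : ∀ b h → b ℕ.≤ 1 → ∀ z → + suc b * z ≡ + 0 mod suc (h ℕ.+ h) → z ≡ + 0 mod suc (h ℕ.+ h)
one-or-two-invertible-mod-odd zero          h _        z = subst (_≡ + 0 mod suc (h ℕ.+ h)) (ℤₚ.*-identityˡ z)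
one-or-two-invertible-mod-odd (suc zero)    h _        z = two-invertible-mod-odd h z
one-or-two-invertible-mod-odd (suc (suc _)) h (s≤s ()) z

-- k = 2m with m = 2q + b + 1, b ∈ {0, 1}.  Position v < k lies in the lower half v < m or the upper half
-- v = m + w; the upper half repeats the lower one with all signs flipped, so v ↦ v ± m is the opposite step.
module ExplicitStarter (q b h : ℕ) (b≤1 : b ℕ.≤ 1) (1≤q+b : 1 ℕ.≤ q ℕ.+ b) where

  S m k N t : ℕ
  S = q ℕ.+ q ℕ.+ b
  m = suc S
  k = m ℕ.+ m
  N = suc k
  t = suc (h ℕ.+ h)

  lower upper : ℕ → Bool
  lower v = v ℕ.<ᵇ m
  upper v = not (lower v)

  residue : ℕ → ℕ
  residue v = if lower v then v else v ∸ m

  residue<m : ∀ v → v ℕ.< k → residue v ℕ.< m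
  residue<m v v<k with <ᵇ-view v m
  ... | inj₁ (v<m , eq) rewrite eq = v<m
  ... | inj₂ (m≤v , eq) rewrite eq = subst (v ∸ m ℕ.<_) (ℕₚ.m+n∸m≡n m m) (ℕₚ.∸-monoˡ-< v<k m≤v)

  residue-injective : ∀ v v′ → residue v ≡ residue v′ → upper v ≡ upper v′ → v ≡ v′
  residue-injective v v′ same-residue same-half with <ᵇ-view v m | <ᵇ-view v′ m
  ... | inj₁ (_ , eq)   | inj₁ (_ , eq′)   rewrite eq | eq′ = same-residue
  ... | inj₂ (m≤v , eq) | inj₂ (m≤v′ , eq′) rewrite eq | eq′ = ℕₚ.∸-cancelʳ-≡ m≤v m≤v′ same-residue
  ... | inj₁ (_ , eq)   | inj₂ (_ , eq′)   rewrite eq | eq′ = contradiction same-half λ ()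
  ... | inj₂ (_ , eq)   | inj₁ (_ , eq′)   rewrite eq | eq′ = contradiction same-half λ ()

  -- Distinct magnitudes 1 ≤ G(w) ≤ m with arbitrary signs stay distinct and nonzero mod N = 2m + 1.
  module Signed (σ : ℕ → Bool) (G : ℕ → ℕ) (F : ℕ → ℤ)
                (G≥1 : ∀ w → w ℕ.< m → 1 ℕ.≤ G w) (G≤m : ∀ w → w ℕ.< m → G w ℕ.≤ m)
                (G-injective : ∀ w w′ → w ℕ.< m → w′ ℕ.< m → G w ≡ G w′ → w ≡ w′)
                (F-signed : ∀ v → v ℕ.< k → F v ≡ negateIf (σ (residue v) xor upper v) (+ G (residue v)) mod N) where

    injective : ∀ v v′ → v ℕ.< k → v′ ℕ.< k → F v ≡ F v′ mod N → v ≡ v′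
    injective v v′ v<k v′<k Fv≡Fv′ = residue-injective v v′ same-residue
      (xor-cancelˡ (σ (residue v)) (trans (proj₁ same) (cong (λ w → σ w xor upper v′) (sym same-residue))))
      where
      w<m : residue v ℕ.< m
      w<m = residue<m v v<k
      w′<m : residue v′ ℕ.< m
      w′<m = residue<m v′ v′<k
      same : (σ (residue v) xor upper v) ≡ (σ (residue v′) xor upper v′) × G (residue v) ≡ G (residue v′)
      same = negateIf-injective-mod _ _ (G≥1 _ w<m) (G≥1 _ w′<m) (s≤s (ℕₚ.+-mono-≤ (G≤m _ w<m) (G≤m _ w′<m)))
               (≡-mod-trans (≡-mod-sym (F-signed v v<k)) (≡-mod-trans Fv≡Fv′ (F-signed v′ v′<k)))
      same-residue : residue v ≡ residue v′
      same-residue = G-injective _ _ w<m w′<m (proj₂ same)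

    nonzero : ∀ v → v ℕ.< k → ¬ F v ≡ + 0 mod N
    nonzero v v<k Fv≡0 = ℕₚ.<⇒≢ (G≥1 _ w<m) (sym (≡0-mod⇒≡0 (s≤s (ℕₚ.≤-trans (G≤m _ w<m) (ℕₚ.m≤m+n m m)))
      (negateIf≡0-mod (σ (residue v) xor upper v) (≡-mod-trans (≡-mod-sym (F-signed v v<k)) Fv≡0))))
      where
      w<m : residue v ℕ.< m
      w<m = residue<m v v<k

  negative : ℕ → Bool
  negative w = odd w xor (q ℕ.<ᵇ w)

  lowerOffset : ℕ → ℤ
  lowerOffset w = negateIf (negative w) (+ suc w)

  offsetℕ : ℕ → ℤ
  offsetℕ v = if lower v then lowerOffset v else - lowerOffset (v ∸ m)

  offsetℕ-signed : ∀ v → offsetℕ v ≡ negateIf (negative (residue v) xor upper v) (+ suc (residue v))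
  offsetℕ-signed v with <ᵇ-view v m
  ... | inj₁ (_ , eq) rewrite eq = cong (λ c → negateIf c (+ suc v)) (sym (xor-identityʳ (negative v)))
  ... | inj₂ (_ , eq) rewrite eq =
    trans (neg-negateIf (negative (v ∸ m)) _) (cong (λ c → negateIf c (+ suc (v ∸ m))) (sym (xor-true (negative (v ∸ m)))))

  module Offsets = Signed negative suc offsetℕ (λ _ _ → s≤s z≤n) (λ _ w<m → w<m)
                          (λ _ _ _ _ → ℕₚ.suc-injective) (λ v _ → ≡-mod-reflexive (offsetℕ-signed v))

  lowerDifference : ℕ → ℤ
  lowerDifference w = (if suc w ℕ.<ᵇ m then lowerOffset (suc w) else - lowerOffset 0) - lowerOffset w

  differenceℕ : ℕ → ℤ
  differenceℕ v = offsetℕ (suc v ℕ.% k) - offsetℕ v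

  private
    m<k : m ℕ.< k
    m<k = s≤s (ℕₚ.m≤n+m m S)

    last-residue : ∀ {v} → m ℕ.≤ v → suc v ≡ k → suc (v ∸ m) ≡ m
    last-residue m≤v v+1≡k = trans (sym (ℕₚ.+-∸-assoc 1 m≤v)) (trans (cong (_∸ m) v+1≡k) (ℕₚ.m+n∸m≡n m m))

    upper-successor : ∀ v → m ℕ.≤ v → suc v ℕ.< k → suc (v ∸ m) ℕ.< m
    upper-successor v m≤v v+1<k = subst (suc (suc (v ∸ m)) ℕ.≤_) (ℕₚ.m+n∸m≡n m m)
      (subst (ℕ._≤ k ∸ m) (ℕₚ.+-∸-assoc 2 m≤v) (ℕₚ.∸-monoˡ-≤ m v+1<k))

    negate-difference : ∀ a b → (- a) - (- b) ≡ - (a - b)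
    negate-difference = solve-∀

    negate-wrap : ∀ a b → a - (- b) ≡ - ((- a) - b)
    negate-wrap = solve-∀

  differenceℕ-halves : ∀ v → v ℕ.< k → differenceℕ v ≡ negateIf (upper v) (lowerDifference (residue v))
  differenceℕ-halves v v<k with <ᵇ-view v m
  differenceℕ-halves v v<k | inj₁ (v<m , eq)
    rewrite eq | ℕDivMod.m<n⇒m%n≡m (ℕₚ.<-≤-trans (s≤s v<m) m<k) with <ᵇ-view (suc v) m
  ... | inj₁ (_ , eq′) rewrite eq′ = refl
  ... | inj₂ (_ , eq′) rewrite eq′ | ℕₚ.m≤n⇒m∸n≡0 (ℕₚ.≤-pred v<m) = refl
  differenceℕ-halves v v<k | inj₂ (m≤v , eq) rewrite eq with ℕₚ.m≤n⇒m<n∨m≡n v<k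
  ... | inj₁ v+1<k
    rewrite ℕDivMod.m<n⇒m%n≡m v+1<k | <ᵇ-false {suc v} {m} (ℕₚ.m≤n⇒m≤1+n m≤v) | ℕₚ.+-∸-assoc 1 m≤v
          | <ᵇ-true {suc (v ∸ m)} {m} (upper-successor v m≤v v+1<k) =
    negate-difference (lowerOffset (suc (v ∸ m))) (lowerOffset (v ∸ m))
  ... | inj₂ v+1≡k
    rewrite trans (ℕDivMod.%-congˡ {o = k} v+1≡k) (ℕDivMod.n%n≡0 k)
          | <ᵇ-false {suc (v ∸ m)} {m} (ℕₚ.≤-reflexive (sym (last-residue m≤v v+1≡k))) =
    negate-wrap (lowerOffset 0) (lowerOffset (v ∸ m))

  data Segment (w : ℕ) : Set where
    ascending  : w ℕ.< q → Segment w
    turning    : w ≡ q → Segment w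
    descending : q ℕ.< w → suc w ℕ.< m → Segment w
    closing    : suc w ≡ m → Segment w

  segment : ∀ w → w ℕ.< m → Segment w
  segment w w<m with ℕₚ.<-cmp w q
  ... | tri< w<q _ _ = ascending w<q
  ... | tri≈ _ w≡q _ = turning w≡q
  ... | tri> _ _ q<w with ℕₚ.m≤n⇒m<n∨m≡n w<m
  ...   | inj₁ w+1<m = descending q<w w+1<m
  ...   | inj₂ w+1≡m = closing w+1≡m

  -- Modulo N = 2S + 3 the odd jump 2w + 3 of a descending step is the even jump 2(S - w) with the other sign.
  differenceSize : ℕ → ℕ
  differenceSize w =
    if w ℕ.<ᵇ q then suc (suc w ℕ.+ suc w)
    else if w ℕ.<ᵇ suc q then 1
    else if suc w ℕ.<ᵇ m then (S ∸ w) ℕ.+ (S ∸ w)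
    else (q ℕ.+ b) ℕ.+ (q ℕ.+ b)

  differenceSign : ℕ → Bool
  differenceSign w = if w ℕ.<ᵇ q then not (negative w) else if suc w ℕ.<ᵇ m then negative w else false

  private
    q<S : q ℕ.< S
    q<S = ℕₚ.≤-trans (ℕₚ.≤-reflexive (ℕₚ.+-comm 1 q))
            (ℕₚ.≤-trans (ℕₚ.+-monoʳ-≤ q 1≤q+b) (ℕₚ.≤-reflexive (sym (ℕₚ.+-assoc q q b))))

    closing⇒q<w : ∀ {w} → suc w ≡ m → q ℕ.< w
    closing⇒q<w w+1≡m = subst (q ℕ.<_) (sym (ℕₚ.suc-injective w+1≡m)) q<S

  segmentSize : ∀ {w} → Segment w → ℕ
  segmentSize {w} (ascending _)    = suc (suc w ℕ.+ suc w)
  segmentSize     (turning _)      = 1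
  segmentSize {w} (descending _ _) = (S ∸ w) ℕ.+ (S ∸ w)
  segmentSize     (closing _)      = (q ℕ.+ b) ℕ.+ (q ℕ.+ b)

  differenceSize-segment : ∀ {w} (σ : Segment w) → differenceSize w ≡ segmentSize σ
  differenceSize-segment (ascending w<q) rewrite <ᵇ-true w<q = refl
  differenceSize-segment (turning refl)
    rewrite <ᵇ-false {q} {q} ℕₚ.≤-refl | <ᵇ-true {q} {suc q} (ℕₚ.n<1+n q) = refl
  differenceSize-segment (descending q<w w+1<m)
    rewrite <ᵇ-false (ℕₚ.<⇒≤ q<w) | <ᵇ-false q<w | <ᵇ-true w+1<m = refl
  differenceSize-segment {w} (closing w+1≡m)
    rewrite <ᵇ-false {w} {q} (ℕₚ.<⇒≤ (closing⇒q<w w+1≡m)) | <ᵇ-false {w} {suc q} (closing⇒q<w w+1≡m)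
          | <ᵇ-false {suc w} {m} (ℕₚ.≤-reflexive (sym w+1≡m)) = refl

  private
    lowerDifference-inner : ∀ w → suc w ℕ.< m → lowerDifference w ≡ lowerOffset (suc w) - lowerOffset w
    lowerDifference-inner w w+1<m rewrite <ᵇ-true w+1<m = refl

    negative-flips-before : ∀ w → w ℕ.< q → negative (suc w) ≡ not (negative w)
    negative-flips-before w w<q rewrite <ᵇ-false {q} {suc w} w<q | <ᵇ-false {q} {w} (ℕₚ.<⇒≤ w<q) =
      trans (xor-identityʳ (not (odd w))) (cong not (sym (xor-identityʳ (odd w))))

    negative-stays-at-q : negative (suc q) ≡ negative q
    negative-stays-at-q rewrite <ᵇ-true {q} {suc q} (ℕₚ.n<1+n q) | <ᵇ-false {q} {q} ℕₚ.≤-refl =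
      trans (xor-true (not (odd q))) (trans (not-involutive (odd q)) (sym (xor-identityʳ (odd q))))

    negative-flips-after : ∀ w → q ℕ.< w → negative (suc w) ≡ not (negative w)
    negative-flips-after w q<w rewrite <ᵇ-true {q} {suc w} (ℕₚ.m<n⇒m<1+n q<w) | <ᵇ-true {q} {w} q<w =
      trans (xor-true (not (odd w))) (cong not (sym (xor-true (odd w))))

    alternating-jump : ∀ c w → negateIf (not c) (+ suc (suc w)) - negateIf c (+ suc w) ≡ negateIf (not c) (+ suc (suc w ℕ.+ suc w))
    alternating-jump false w = jump (+ w)
      where
      jump : ∀ x → - (+ 1 + (+ 1 + x)) - (+ 1 + x) ≡ - (+ 1 + (+ 1 + x) + (+ 1 + x))
      jump = solve-∀
    alternating-jump true w = jump (+ w)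
      where
      jump : ∀ x → (+ 1 + (+ 1 + x)) - - (+ 1 + x) ≡ + 1 + (+ 1 + x) + (+ 1 + x)
      jump = solve-∀

    unit-jump : ∀ c w → negateIf c (+ suc (suc w)) - negateIf c (+ suc w) ≡ negateIf c (+ 1)
    unit-jump false w = jump (+ w)
      where
      jump : ∀ x → (+ 1 + (+ 1 + x)) - (+ 1 + x) ≡ + 1
      jump = solve-∀
    unit-jump true w = jump (+ w)
      where
      jump : ∀ x → - (+ 1 + (+ 1 + x)) - - (+ 1 + x) ≡ - (+ 1)
      jump = solve-∀

    complementary-mod : ∀ {n} c x y → x ℕ.+ y ≡ n → negateIf (not c) (+ x) ≡ negateIf c (+ y) mod n
    complementary-mod false x y refl = congruent (divides (- + 1) (sum (+ x) (+ y)))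
      where
      sum : ∀ a b → - a - b ≡ - + 1 * (a + b)
      sum = solve-∀
    complementary-mod true x y refl = congruent (divides (+ 1) (sum (+ x) (+ y)))
      where
      sum : ∀ a b → a - - b ≡ + 1 * (a + b)
      sum = solve-∀

    q<m : q ℕ.< m
    q<m = ℕₚ.m<n⇒m<1+n q<S

    sign-ascending : ∀ w → w ℕ.< q → differenceSign w ≡ not (negative w)
    sign-ascending w w<q rewrite <ᵇ-true w<q = refl

    sign-inner : ∀ w → q ℕ.≤ w → suc w ℕ.< m → differenceSign w ≡ negative w
    sign-inner w q≤w w+1<m rewrite <ᵇ-false q≤w | <ᵇ-true w+1<m = refl

    sign-closing : ∀ w → suc w ≡ m → differenceSign w ≡ false
    sign-closing w w+1≡m
      rewrite <ᵇ-false {w} {q} (ℕₚ.<⇒≤ (closing⇒q<w w+1≡m)) | <ᵇ-false {suc w} {m} (ℕₚ.≤-reflexive (sym w+1≡m)) = refl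

    jumps-sum-to-N : ∀ w → suc w ℕ.< m → suc (suc w ℕ.+ suc w) ℕ.+ ((S ∸ w) ℕ.+ (S ∸ w)) ≡ N
    jumps-sum-to-N w w+1<m = trans (regroup w (S ∸ w))
      (cong (λ e → suc (suc (e ℕ.+ suc e))) (ℕₚ.m∸n+n≡m (ℕₚ.≤-pred (ℕₚ.<⇒≤ w+1<m))))
      where
      regroup : ∀ w e → suc (suc w ℕ.+ suc w) ℕ.+ (e ℕ.+ e) ≡ suc (suc ((e ℕ.+ w) ℕ.+ suc (e ℕ.+ w)))
      regroup = ℕSolver.solve-∀

    lowerDifference-closing : lowerDifference S ≡ - + 1 - lowerOffset S
    lowerDifference-closing rewrite <ᵇ-false {m} {m} ℕₚ.≤-refl = refl

    negative-at-end : negative S ≡ not (odd b)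
    negative-at-end rewrite <ᵇ-true q<S = trans (xor-true (odd S)) (cong not (odd-double+ q b))

  lowerDifference-segment : ∀ {w} (σ : Segment w) → lowerDifference w ≡ negateIf (differenceSign w) (+ segmentSize σ) mod N
  lowerDifference-segment {w} (ascending w<q) = ≡-mod-reflexive (begin
    lowerDifference w
      ≡⟨ lowerDifference-inner w (ℕₚ.≤-trans (s≤s w<q) q<m) ⟩
    lowerOffset (suc w) - lowerOffset w
      ≡⟨ cong (λ c → negateIf c (+ suc (suc w)) - lowerOffset w) (negative-flips-before w w<q) ⟩
    negateIf (not (negative w)) (+ suc (suc w)) - lowerOffset w
      ≡⟨ alternating-jump (negative w) w ⟩
    negateIf (not (negative w)) (+ suc (suc w ℕ.+ suc w))
      ≡⟨ cong (λ c → negateIf c (+ suc (suc w ℕ.+ suc w))) (sign-ascending w w<q) ⟨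
    negateIf (differenceSign w) (+ suc (suc w ℕ.+ suc w))
      ∎)
    where open ≡-Reasoning
  lowerDifference-segment (turning refl) = ≡-mod-reflexive (begin
    lowerDifference q
      ≡⟨ lowerDifference-inner q (s≤s q<S) ⟩
    lowerOffset (suc q) - lowerOffset q
      ≡⟨ cong (λ c → negateIf c (+ suc (suc q)) - lowerOffset q) negative-stays-at-q ⟩
    negateIf (negative q) (+ suc (suc q)) - lowerOffset q
      ≡⟨ unit-jump (negative q) q ⟩
    negateIf (negative q) (+ 1)
      ≡⟨ cong (λ c → negateIf c (+ 1)) (sign-inner q ℕₚ.≤-refl (s≤s q<S)) ⟨
    negateIf (differenceSign q) (+ 1)
      ∎)
    where open ≡-Reasoning
  lowerDifference-segment {w} (descending q<w w+1<m) = begin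
    lowerDifference w
      ≡⟨ lowerDifference-inner w w+1<m ⟩
    lowerOffset (suc w) - lowerOffset w
      ≡⟨ cong (λ c → negateIf c (+ suc (suc w)) - lowerOffset w) (negative-flips-after w q<w) ⟩
    negateIf (not (negative w)) (+ suc (suc w)) - lowerOffset w
      ≡⟨ alternating-jump (negative w) w ⟩
    negateIf (not (negative w)) (+ suc (suc w ℕ.+ suc w))
      ≈⟨ complementary-mod (negative w) _ _ (jumps-sum-to-N w w+1<m) ⟩
    negateIf (negative w) (+ ((S ∸ w) ℕ.+ (S ∸ w)))
      ≡⟨ cong (λ c → negateIf c (+ ((S ∸ w) ℕ.+ (S ∸ w)))) (sign-inner w (ℕₚ.<⇒≤ q<w) w+1<m) ⟨
    negateIf (differenceSign w) (+ ((S ∸ w) ℕ.+ (S ∸ w)))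
      ∎
    where open ≡-mod-Reasoning N
  lowerDifference-segment {w} (closing w+1≡m) with ℕₚ.suc-injective w+1≡m
  ... | refl = begin
    lowerDifference S
      ≡⟨ lowerDifference-closing ⟩
    - + 1 - lowerOffset S
      ≡⟨ cong (λ c → - + 1 - negateIf c (+ m)) negative-at-end ⟩
    - + 1 - negateIf (not (odd b)) (+ m)
      ≈⟨ closing-jump q b b≤1 ⟩
    + ((q ℕ.+ b) ℕ.+ (q ℕ.+ b))
      ≡⟨ cong (λ c → negateIf c (+ ((q ℕ.+ b) ℕ.+ (q ℕ.+ b)))) (sign-closing S w+1≡m) ⟨
    negateIf (differenceSign S) (+ ((q ℕ.+ b) ℕ.+ (q ℕ.+ b)))
      ∎
    where open ≡-mod-Reasoning N

  private
    double-peak≤m : (q ℕ.+ b) ℕ.+ (q ℕ.+ b) ℕ.≤ m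
    double-peak≤m = ℕₚ.≤-trans (ℕₚ.≤-reflexive (regroup q b))
      (ℕₚ.≤-trans (ℕₚ.+-monoʳ-≤ S b≤1) (ℕₚ.≤-reflexive (ℕₚ.+-comm S 1)))
      where
      regroup : ∀ q b → (q ℕ.+ b) ℕ.+ (q ℕ.+ b) ≡ (q ℕ.+ q ℕ.+ b) ℕ.+ b
      regroup = ℕSolver.solve-∀

    descent<peak : ∀ w → q ℕ.< w → suc w ℕ.< m → S ∸ w ℕ.< q ℕ.+ b
    descent<peak w q<w w+1<m = ℕₚ.+-cancelʳ-< q (S ∸ w) (q ℕ.+ b) (begin-strict
      S ∸ w ℕ.+ q         <⟨ ℕₚ.+-monoʳ-< (S ∸ w) q<w ⟩
      S ∸ w ℕ.+ w         ≡⟨ ℕₚ.m∸n+n≡m (ℕₚ.≤-pred (ℕₚ.<⇒≤ w+1<m)) ⟩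
      S                   ≡⟨ regroup q b ⟩
      q ℕ.+ b ℕ.+ q       ∎)
      where
      open ℕₚ.≤-Reasoning
      regroup : ∀ q b → q ℕ.+ q ℕ.+ b ≡ q ℕ.+ b ℕ.+ q
      regroup = ℕSolver.solve-∀

  segmentSize≥1 : ∀ {w} (σ : Segment w) → 1 ℕ.≤ segmentSize σ
  segmentSize≥1 (ascending _)          = s≤s z≤n
  segmentSize≥1 (turning _)            = s≤s z≤n
  segmentSize≥1 {w} (descending q<w w+1<m) =
    ℕₚ.≤-trans (ℕₚ.m<n⇒0<n∸m (ℕₚ.≤-pred w+1<m)) (ℕₚ.m≤m+n (S ∸ w) (S ∸ w))
  segmentSize≥1 (closing _)            = ℕₚ.≤-trans 1≤q+b (ℕₚ.m≤m+n (q ℕ.+ b) (q ℕ.+ b))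

  segmentSize≤m : ∀ {w} (σ : Segment w) → segmentSize σ ℕ.≤ m
  segmentSize≤m (ascending w<q)        = s≤s (ℕₚ.≤-trans (ℕₚ.+-mono-≤ w<q w<q) (ℕₚ.m≤m+n (q ℕ.+ q) b))
  segmentSize≤m (turning _)            = s≤s z≤n
  segmentSize≤m {w} (descending q<w w+1<m) =
    ℕₚ.≤-trans (ℕₚ.+-mono-≤ (ℕₚ.<⇒≤ (descent<peak w q<w w+1<m)) (ℕₚ.<⇒≤ (descent<peak w q<w w+1<m))) double-peak≤m
  segmentSize≤m (closing _)            = double-peak≤m

  segmentSize-injective : ∀ {w w′} (σ : Segment w) (σ′ : Segment w′) → segmentSize σ ≡ segmentSize σ′ → w ≡ w′
  segmentSize-injective {w} {w′} (ascending _) (ascending _) e =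
    ℕₚ.suc-injective (double-injective (suc w) (suc w′) (ℕₚ.suc-injective e))
  segmentSize-injective (ascending _) (turning _) e = contradiction (ℕₚ.suc-injective e) λ ()
  segmentSize-injective {w} {w′} (ascending _) (descending _ _) e = contradiction e (odd≢double (suc w) (S ∸ w′))
  segmentSize-injective {w} (ascending _) (closing _) e = contradiction e (odd≢double (suc w) (q ℕ.+ b))
  segmentSize-injective (turning _) (ascending _) e = contradiction (ℕₚ.suc-injective (sym e)) λ ()
  segmentSize-injective (turning w≡q) (turning w′≡q) _ = trans w≡q (sym w′≡q)
  segmentSize-injective {w′ = w′} (turning _) (descending _ _) e = contradiction e (odd≢double 0 (S ∸ w′))
  segmentSize-injective (turning _) (closing _) e = contradiction e (odd≢double 0 (q ℕ.+ b))
  segmentSize-injective {w} {w′} (descending _ _) (ascending _) e = contradiction (sym e) (odd≢double (suc w′) (S ∸ w))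
  segmentSize-injective {w} (descending _ _) (turning _) e = contradiction (sym e) (odd≢double 0 (S ∸ w))
  segmentSize-injective {w} {w′} (descending _ w+1<m) (descending _ w′+1<m) e =
    ℕₚ.∸-cancelˡ-≡ (ℕₚ.≤-pred (ℕₚ.<⇒≤ w+1<m)) (ℕₚ.≤-pred (ℕₚ.<⇒≤ w′+1<m)) (double-injective (S ∸ w) (S ∸ w′) e)
  segmentSize-injective {w} (descending q<w w+1<m) (closing _) e =
    contradiction (double-injective (S ∸ w) (q ℕ.+ b) e) (ℕₚ.<⇒≢ (descent<peak w q<w w+1<m))
  segmentSize-injective {w′ = w′} (closing _) (ascending _) e = contradiction (sym e) (odd≢double (suc w′) (q ℕ.+ b))
  segmentSize-injective (closing _) (turning _) e = contradiction (sym e) (odd≢double 0 (q ℕ.+ b))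
  segmentSize-injective {w′ = w′} (closing _) (descending q<w′ w′+1<m) e =
    contradiction (double-injective (S ∸ w′) (q ℕ.+ b) (sym e)) (ℕₚ.<⇒≢ (descent<peak w′ q<w′ w′+1<m))
  segmentSize-injective (closing w+1≡m) (closing w′+1≡m) _ = ℕₚ.suc-injective (trans w+1≡m (sym w′+1≡m))

  lowerDifference-signed : ∀ w → w ℕ.< m → lowerDifference w ≡ negateIf (differenceSign w) (+ differenceSize w) mod N
  lowerDifference-signed w w<m = ≡-mod-trans (lowerDifference-segment σ)
    (≡-mod-reflexive (cong (λ z → negateIf (differenceSign w) (+ z)) (sym (differenceSize-segment σ))))
    where
    σ : Segment w
    σ = segment w w<m

  differenceℕ-signed : ∀ v → v ℕ.< k →
    differenceℕ v ≡ negateIf (differenceSign (residue v) xor upper v) (+ differenceSize (residue v)) mod N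
  differenceℕ-signed v v<k = ≡-mod-trans (≡-mod-reflexive (differenceℕ-halves v v<k))
    (≡-mod-trans (negateIf-cong-mod (upper v) (lowerDifference-signed (residue v) (residue<m v v<k)))
      (≡-mod-reflexive (negateIf-xor (upper v) (differenceSign (residue v)) _)))

  differenceSize≥1 : ∀ w → w ℕ.< m → 1 ℕ.≤ differenceSize w
  differenceSize≥1 w w<m = subst (1 ℕ.≤_) (sym (differenceSize-segment σ)) (segmentSize≥1 σ)
    where
    σ : Segment w
    σ = segment w w<m

  differenceSize≤m : ∀ w → w ℕ.< m → differenceSize w ℕ.≤ m
  differenceSize≤m w w<m = subst (ℕ._≤ m) (sym (differenceSize-segment σ)) (segmentSize≤m σ)
    where
    σ : Segment w
    σ = segment w w<m

  differenceSize-injective : ∀ w w′ → w ℕ.< m → w′ ℕ.< m → differenceSize w ≡ differenceSize w′ → w ≡ w′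
  differenceSize-injective w w′ w<m w′<m e =
    segmentSize-injective σ σ′ (trans (sym (differenceSize-segment σ)) (trans e (differenceSize-segment σ′)))
    where
    σ : Segment w
    σ = segment w w<m
    σ′ : Segment w′
    σ′ = segment w′ w′<m

  module Differences = Signed differenceSign differenceSize differenceℕ
    differenceSize≥1 differenceSize≤m differenceSize-injective differenceℕ-signed

  oppositeℕ : ℕ → ℕ
  oppositeℕ v = if lower v then v ℕ.+ m else v ∸ m

  oppositeℕ<k : ∀ v → v ℕ.< k → oppositeℕ v ℕ.< k
  oppositeℕ<k v v<k with <ᵇ-view v m
  ... | inj₁ (v<m , eq) rewrite eq = ℕₚ.+-monoˡ-< m v<m
  ... | inj₂ (_ , eq)   rewrite eq = ℕₚ.≤-<-trans (ℕₚ.m∸n≤m v m) v<k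

  opposite-residue : ∀ v → v ℕ.< k → residue (oppositeℕ v) ≡ residue v × upper (oppositeℕ v) ≡ not (upper v)
  opposite-residue v v<k with <ᵇ-view v m
  ... | inj₁ (_ , eq) rewrite eq | <ᵇ-false {v ℕ.+ m} {m} (ℕₚ.m≤n+m m v) = ℕₚ.m+n∸n≡m v m , refl
  ... | inj₂ (m≤v , eq)
    rewrite eq | <ᵇ-true {v ∸ m} {m} (subst (v ∸ m ℕ.<_) (ℕₚ.m+n∸m≡n m m) (ℕₚ.∸-monoˡ-< v<k m≤v)) = refl , refl

  differenceℕ-opposite : ∀ v → v ℕ.< k → differenceℕ (oppositeℕ v) + differenceℕ v ≡ + 0
  differenceℕ-opposite v v<k = begin
    differenceℕ (oppositeℕ v) + differenceℕ v
      ≡⟨ cong₂ _+_ (differenceℕ-halves (oppositeℕ v) (oppositeℕ<k v v<k)) (differenceℕ-halves v v<k) ⟩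
    negateIf (upper (oppositeℕ v)) (lowerDifference (residue (oppositeℕ v))) + d
      ≡⟨ cong₂ (λ c w → negateIf c (lowerDifference w) + d) (proj₂ same) (proj₁ same) ⟩
    negateIf (not (upper v)) (lowerDifference (residue v)) + d
      ≡⟨ cong (_+ d) (neg-negateIf (upper v) _) ⟨
    - d + d
      ≡⟨ ℤₚ.+-inverseˡ d ⟩
    + 0
      ∎
    where
    open ≡-Reasoning
    d : ℤ
    d = negateIf (upper v) (lowerDifference (residue v))
    same : residue (oppositeℕ v) ≡ residue v × upper (oppositeℕ v) ≡ not (upper v)
    same = opposite-residue v v<k

  drift : ℤ
  drift = + suc b

  drift-invertible : ∀ z → drift * z ≡ + 0 mod t → z ≡ + 0 mod t
  drift-invertible = one-or-two-invertible-mod-odd b h b≤1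

  peak : ℕ
  peak = suc (q ℕ.+ b)

  falling : ℕ → Bool
  falling w = (q ℕ.+ b) ℕ.<ᵇ w

  -- Heights follow this tent; over a lap it rises by tent m = 1 + b, which is the drift.
  tent : ℕ → ℤ
  tent w = if w ℕ.<ᵇ suc peak then + w else (+ peak + + peak) - + w

  tent-step : ∀ w → tent (suc w) ≡ tent w + negateIf (falling w) (+ 1)
  tent-step w with <ᵇ-view (q ℕ.+ b) w
  ... | inj₂ (w≤q+b , eq) rewrite eq | <ᵇ-true {w} {suc peak} (s≤s (ℕₚ.m≤n⇒m≤1+n w≤q+b))
                                     | <ᵇ-true {suc w} {suc peak} (s≤s (s≤s w≤q+b)) = ℤₚ.+-comm (+ 1) (+ w)
  ... | inj₁ (q+b<w , eq) rewrite eq with ℕₚ.m≤n⇒m<n∨m≡n q+b<w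
  ...   | inj₂ refl rewrite <ᵇ-true {peak} {suc peak} (ℕₚ.n<1+n peak) | <ᵇ-false {suc peak} {suc peak} ℕₚ.≤-refl =
    down (+ peak)
    where
    down : ∀ c → (c + c) - (+ 1 + c) ≡ c + - + 1
    down = solve-∀
  ...   | inj₁ peak<w rewrite <ᵇ-false {w} {suc peak} peak<w | <ᵇ-false {suc w} {suc peak} (ℕₚ.m≤n⇒m≤1+n peak<w) =
    down (+ peak) (+ w)
    where
    down : ∀ c w → (c + c) - (+ 1 + w) ≡ ((c + c) - w) + - + 1
    down = solve-∀

  tent-end : tent m ≡ drift
  tent-end with <ᵇ-view m (suc peak)
  ... | inj₂ (_ , eq) rewrite eq = fold (+ q) (+ b)
    where
    fold : ∀ x y → ((+ 1 + (x + y)) + (+ 1 + (x + y))) - (+ 1 + ((x + x) + y)) ≡ + 1 + y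
    fold = solve-∀
  ... | inj₁ (m<peak+1 , eq) rewrite eq = cong (λ z → + suc (z ℕ.+ b)) q+q≡0
    where
    q+q≤q+0 : q ℕ.+ q ℕ.≤ q ℕ.+ 0
    q+q≤q+0 = subst (q ℕ.+ q ℕ.≤_) (sym (ℕₚ.+-identityʳ q)) (ℕₚ.+-cancelʳ-≤ b (q ℕ.+ q) q (ℕₚ.≤-pred (ℕₚ.≤-pred m<peak+1)))
    q≡0 : q ≡ 0
    q≡0 = ℕₚ.n≤0⇒n≡0 (ℕₚ.+-cancelˡ-≤ q q 0 q+q≤q+0)
    q+q≡0 : q ℕ.+ q ≡ 0
    q+q≡0 = cong (λ z → z ℕ.+ z) q≡0

  tent-last : ∀ w → suc w ≡ m → tent w + negateIf (falling w) (+ 1) ≡ drift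
  tent-last w w+1≡m = trans (sym (tent-step w)) (trans (cong tent w+1≡m) tent-end)

  oddSize evenSize : Fin h → ℕ
  oddSize s = suc (toℕ s ℕ.+ toℕ s)
  evenSize s = suc (oddSize s)

  stepℕ : Fin h → ℕ → ℤ
  stepℕ s v = if lower v then negateIf (falling v) (+ evenSize s) else negateIf (not (falling (v ∸ m))) (+ oddSize s)

  heightℕ : Fin h → ℕ → ℤ
  heightℕ s v = if lower v then + evenSize s * tent v else drift * + evenSize s - + oddSize s * tent (v ∸ m)

  private
    scaled-step : ∀ c x a → x * (a + negateIf c (+ 1)) ≡ x * a + negateIf c x
    scaled-step false = step
      where
      step : ∀ x a → x * (a + + 1) ≡ x * a + x
      step = solve-∀
    scaled-step true = step
      where
      step : ∀ x a → x * (a + - + 1) ≡ x * a + - x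
      step = solve-∀

    subtracted-step : ∀ c x a y → y - x * (a + negateIf c (+ 1)) ≡ (y - x * a) + negateIf (not c) x
    subtracted-step false = step
      where
      step : ∀ x a y → y - x * (a + + 1) ≡ (y - x * a) + - x
      step = solve-∀
    subtracted-step true = step
      where
      step : ∀ x a y → y - x * (a + - + 1) ≡ (y - x * a) + x
      step = solve-∀

  heightℕ-next : ∀ s v → suc v ℕ.< k → heightℕ s (suc v) ≡ heightℕ s v + stepℕ s v
  heightℕ-next s v v+1<k with <ᵇ-view v m
  heightℕ-next s v v+1<k | inj₁ (v<m , eq) rewrite eq with ℕₚ.m≤n⇒m<n∨m≡n v<m
  ... | inj₁ v+1<m rewrite <ᵇ-true v+1<m =
    trans (cong (+ evenSize s *_) (tent-step v)) (scaled-step (falling v) (+ evenSize s) (tent v))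
  ... | inj₂ v+1≡m rewrite <ᵇ-false {suc v} {m} (ℕₚ.≤-reflexive (sym v+1≡m)) | ℕₚ.m≤n⇒m∸n≡0 (ℕₚ.≤-pred v<m) = begin
    drift * + evenSize s - + oddSize s * + 0            ≡⟨ collapse drift (+ evenSize s) (+ oddSize s) ⟩
    + evenSize s * drift                                 ≡⟨ cong (+ evenSize s *_) (sym (tent-last v v+1≡m)) ⟩
    + evenSize s * (tent v + negateIf (falling v) (+ 1)) ≡⟨ scaled-step (falling v) (+ evenSize s) (tent v) ⟩
    + evenSize s * tent v + negateIf (falling v) (+ evenSize s) ∎
    where
    open ≡-Reasoning
    collapse : ∀ a x y → a * x - y * + 0 ≡ x * a
    collapse = solve-∀
  heightℕ-next s v v+1<k | inj₂ (m≤v , eq)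
    rewrite eq | <ᵇ-false {suc v} {m} (ℕₚ.m≤n⇒m≤1+n m≤v) | ℕₚ.+-∸-assoc 1 m≤v =
    trans (cong (λ z → drift * + evenSize s - + oddSize s * z) (tent-step (v ∸ m)))
      (subtracted-step (falling (v ∸ m)) (+ oddSize s) (tent (v ∸ m)) (drift * + evenSize s))

  private
    last-is-upper : ∀ {v} → suc v ≡ k → m ℕ.≤ v
    last-is-upper v+1≡k = ℕₚ.≤-pred (subst (suc m ℕ.≤_) (sym v+1≡k) (s≤s (ℕₚ.m≤n+m m S)))

  heightℕ-wrap : ∀ s v → suc v ≡ k → heightℕ s 0 + drift ≡ heightℕ s v + stepℕ s v
  heightℕ-wrap s v v+1≡k rewrite <ᵇ-false {v} {m} (last-is-upper v+1≡k) = begin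
    + evenSize s * + 0 + drift
      ≡⟨ collapse (+ oddSize s) drift ⟩
    drift * + evenSize s - + oddSize s * drift
      ≡⟨ cong (λ z → drift * + evenSize s - + oddSize s * z) (sym (tent-last (v ∸ m) w+1≡m)) ⟩
    drift * + evenSize s - + oddSize s * (tent (v ∸ m) + negateIf (falling (v ∸ m)) (+ 1))
      ≡⟨ subtracted-step (falling (v ∸ m)) (+ oddSize s) (tent (v ∸ m)) (drift * + evenSize s) ⟩
    drift * + evenSize s - + oddSize s * tent (v ∸ m) + negateIf (not (falling (v ∸ m))) (+ oddSize s)
      ∎
    where
    open ≡-Reasoning
    w+1≡m : suc (v ∸ m) ≡ m
    w+1≡m = last-residue (last-is-upper v+1≡k) v+1≡k
    collapse : ∀ y a → (+ 1 + y) * + 0 + a ≡ a * (+ 1 + y) - y * a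
    collapse = solve-∀

  stepSize : Fin h → Bool → ℕ
  stepSize s false = evenSize s
  stepSize s true  = oddSize s

  stepℕ-signed : ∀ s v → stepℕ s v ≡ negateIf (falling (residue v) xor upper v) (+ stepSize s (upper v))
  stepℕ-signed s v with <ᵇ-view v m
  ... | inj₁ (_ , eq) rewrite eq = cong (λ c → negateIf c (+ evenSize s)) (sym (xor-identityʳ (falling v)))
  ... | inj₂ (_ , eq) rewrite eq = cong (λ c → negateIf c (+ oddSize s)) (sym (xor-true (falling (v ∸ m))))

  stepSize<t : ∀ s c → stepSize s c ℕ.< t
  stepSize<t s false = s≤s (ℕₚ.≤-trans (ℕₚ.≤-reflexive (sym (ℕₚ.+-suc (suc (toℕ s)) (toℕ s))))
                         (ℕₚ.+-mono-≤ (Finₚ.toℕ<n s) (Finₚ.toℕ<n s)))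
  stepSize<t s true  = ℕₚ.<-trans (ℕₚ.n<1+n (oddSize s)) (stepSize<t s false)

  stepSize-injective : ∀ s s′ c → stepSize s c ≡ stepSize s′ c → s ≡ s′
  stepSize-injective s s′ false eq = Finₚ.toℕ-injective (double-injective _ _ (ℕₚ.suc-injective (ℕₚ.suc-injective eq)))
  stepSize-injective s s′ true  eq = Finₚ.toℕ-injective (double-injective _ _ (ℕₚ.suc-injective eq))

  stepSize-parity : ∀ s s′ c → stepSize s c ≢ stepSize s′ (not c)
  stepSize-parity s s′ false eq = odd≢double (toℕ s) (toℕ s′) (ℕₚ.suc-injective eq)
  stepSize-parity s s′ true  eq = odd≢double (toℕ s′) (toℕ s) (sym (ℕₚ.suc-injective eq))

  private
    stepSize-≡-mod : ∀ {s s′ c c′} → + stepSize s c ≡ + stepSize s′ c′ mod t → stepSize s c ≡ stepSize s′ c′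
    stepSize-≡-mod {s} {s′} {c} {c′} = ≡-mod⇒≡ (stepSize<t s c) (stepSize<t s′ c′)

  stepℕ≢0 : ∀ s v → ¬ stepℕ s v ≡ + 0 mod t
  stepℕ≢0 s v step≡0 = ℕₚ.<⇒≢ (stepSize≥1 (upper v)) (sym (≡0-mod⇒≡0 (stepSize<t s (upper v))
    (negateIf≡0-mod (falling (residue v) xor upper v) (≡-mod-trans (≡-mod-reflexive (sym (stepℕ-signed s v))) step≡0))))
    where
    stepSize≥1 : ∀ c → 1 ℕ.≤ stepSize s c
    stepSize≥1 false = s≤s z≤n
    stepSize≥1 true  = s≤s z≤n

  stepℕ-injective : ∀ s s′ v → stepℕ s v ≡ stepℕ s′ v mod t → s ≡ s′
  stepℕ-injective s s′ v steps≡ = stepSize-injective s s′ (upper v) (stepSize-≡-mod (negateIf-cancel-mod (falling (residue v) xor upper v)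
    (≡-mod-trans (≡-mod-reflexive (sym (stepℕ-signed s v))) (≡-mod-trans steps≡ (≡-mod-reflexive (stepℕ-signed s′ v))))))

  stepℕ-opposite≢0 : ∀ s s′ v → v ℕ.< k → ¬ stepℕ s v + stepℕ s′ (oppositeℕ v) ≡ + 0 mod t
  stepℕ-opposite≢0 s s′ v v<k sum≡0 = stepSize-parity s s′ (upper v) (trans (stepSize-≡-mod (negateIf-cancel-mod c
    (≡-mod-trans (≡-mod-reflexive (sym (stepℕ-signed s v))) (≡-mod-trans (+≡0-mod⇒≡neg sum≡0) (≡-mod-reflexive opposite-negated)))))
    (cong (stepSize s′) (proj₂ same)))
    where
    c : Bool
    c = falling (residue v) xor upper v
    same : residue (oppositeℕ v) ≡ residue v × upper (oppositeℕ v) ≡ not (upper v)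
    same = opposite-residue v v<k
    opposite-negated : - stepℕ s′ (oppositeℕ v) ≡ negateIf c (+ stepSize s′ (upper (oppositeℕ v)))
    opposite-negated = begin
      - stepℕ s′ (oppositeℕ v)
        ≡⟨ cong -_ (stepℕ-signed s′ (oppositeℕ v)) ⟩
      - negateIf (falling (residue (oppositeℕ v)) xor upper (oppositeℕ v)) y
        ≡⟨ cong (λ c′ → - negateIf c′ y) (cong₂ (λ w u → falling w xor u) (proj₁ same) (proj₂ same)) ⟩
      - negateIf (falling (residue v) xor not (upper v)) y
        ≡⟨ cong (λ c′ → - negateIf c′ y) (sym (not-distribʳ-xor (falling (residue v)) (upper v))) ⟩
      - negateIf (not c) y
        ≡⟨ neg-negateIf (not c) y ⟩
      negateIf (not (not c)) y
        ≡⟨ cong (λ c′ → negateIf c′ y) (not-involutive c) ⟩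
      negateIf c y
        ∎
      where
      open ≡-Reasoning
      y : ℤ
      y = + stepSize s′ (upper (oppositeℕ v))

  private
    offset : Fin k → ℤ
    offset p = offsetℕ (toℕ p)

    opposite : Fin k → Fin k
    opposite p = fromℕ< (oppositeℕ<k (toℕ p) (Finₚ.toℕ<n p))

    differences-toℕ : ∀ p → differences offset p ≡ differenceℕ (toℕ p)
    differences-toℕ p = cong (λ v → offsetℕ v - offset p) (toℕ-next p)

    toℕ-opposite : ∀ p → toℕ (opposite p) ≡ oppositeℕ (toℕ p)
    toℕ-opposite p = Finₚ.toℕ-fromℕ< _

  starter : Starter k h
  starter = record
    { offset               = offset
    ; opposite             = opposite
    ; step                 = λ s p → stepℕ s (toℕ p)
    ; height               = λ s p → heightℕ s (toℕ p)
    ; drift                = drift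
    ; offset≢0             = λ p → Offsets.nonzero (toℕ p) (Finₚ.toℕ<n p)
    ; offset-injective     = λ p p′ eq → Finₚ.toℕ-injective (Offsets.injective _ _ (Finₚ.toℕ<n p) (Finₚ.toℕ<n p′) eq)
    ; difference-injective = λ p p′ eq → Finₚ.toℕ-injective (Differences.injective _ _ (Finₚ.toℕ<n p) (Finₚ.toℕ<n p′)
                               (subst₂ (_≡_mod N) (differences-toℕ p) (differences-toℕ p′) eq))
    ; difference-opposite  = λ p → ≡-mod-reflexive (trans (cong₂ _+_ (trans (differences-toℕ (opposite p)) (cong differenceℕ (toℕ-opposite p)))
                               (differences-toℕ p)) (differenceℕ-opposite (toℕ p) (Finₚ.toℕ<n p)))
    ; step≢0               = λ s p → stepℕ≢0 s (toℕ p)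
    ; step-injective       = λ s s′ p → stepℕ-injective s s′ (toℕ p)
    ; step-opposite≢0      = λ s s′ p → subst (λ v → ¬ stepℕ s (toℕ p) + stepℕ s′ v ≡ + 0 mod t) (sym (toℕ-opposite p))
                               (stepℕ-opposite≢0 s s′ (toℕ p) (Finₚ.toℕ<n p))
    ; height-next          = λ s p p+1<k → ≡-mod-reflexive
                               (trans (cong (heightℕ s) (toℕ-next-< p p+1<k)) (heightℕ-next s (toℕ p) p+1<k))
    ; height-wrap          = λ s p p+1≡k → ≡-mod-reflexive
                               (trans (cong (λ v → heightℕ s v + drift) (toℕ-next-last p p+1≡k)) (heightℕ-wrap s (toℕ p) p+1≡k))
    ; drift-invertible     = drift-invertible
    }

  k≥3 : 3 ℕ.≤ k
  k≥3 = s≤s (ℕₚ.+-mono-≤ {1} {S} {1} {m} (ℕₚ.≤-trans 1≤q+b (ℕₚ.≤-trans (ℕₚ.m≤n+m (q ℕ.+ b) q)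
          (ℕₚ.≤-reflexive (sym (ℕₚ.+-assoc q q b))))) (s≤s z≤n))

  factorization : PartialFactorization N t (k ℕ.* t)
  factorization = FromStarter.factorization starter k≥3

halve : ∀ n → ∃ λ q → ∃ λ b → b ℕ.≤ 1 × n ≡ q ℕ.+ q ℕ.+ b
halve n = n ℕ./ 2 , n ℕ.% 2 , ℕₚ.≤-pred (ℕDivMod.m%n<n n 2) , trans (ℕDivMod.m≡m%n+[m/n]*n n 2) (rearrange (n ℕ.% 2) (n ℕ./ 2))
  where
  rearrange : ∀ r d → r ℕ.+ d ℕ.* 2 ≡ d ℕ.+ d ℕ.+ r
  rearrange = ℕSolver.solve-∀

even≥4-split : ∀ {k} → 2 ℕDiv.∣ k → 4 ℕ.≤ k →
  ∃ λ q → ∃ λ b → b ℕ.≤ 1 × 1 ℕ.≤ q ℕ.+ b × k ≡ suc (q ℕ.+ q ℕ.+ b) ℕ.+ suc (q ℕ.+ q ℕ.+ b)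
even≥4-split (ℕDiv.divides (suc (suc j)) k≡) _ with halve (suc j)
... | q , b , b≤1 , j+1≡ =
  q , b , b≤1 , positive q b j+1≡ , trans k≡ (trans (cong (λ n → suc n ℕ.* 2) j+1≡) (double (suc (q ℕ.+ q ℕ.+ b))))
  where
  double : ∀ n → n ℕ.* 2 ≡ n ℕ.+ n
  double = ℕSolver.solve-∀
  positive : ∀ q b → suc j ≡ q ℕ.+ q ℕ.+ b → 1 ℕ.≤ q ℕ.+ b
  positive (suc q) b _ = s≤s z≤n
  positive zero (suc b) _ = s≤s z≤n
  positive zero zero ()
even≥4-split (ℕDiv.divides 0 refl) ()
even≥4-split (ℕDiv.divides 1 refl) (s≤s (s≤s ()))

odd-split : ∀ {t} → ¬ 2 ℕDiv.∣ t → ∃ λ h → t ≡ suc (h ℕ.+ h)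
odd-split {t} 2∤t with halve t
... | h , 0 , _ , t≡ = contradiction (ℕDiv.divides h (trans t≡ (double h))) 2∤t
  where
  double : ∀ h → h ℕ.+ h ℕ.+ 0 ≡ h ℕ.* 2
  double = ℕSolver.solve-∀
... | h , 1 , _ , t≡ = h , trans t≡ (ℕₚ.+-comm (h ℕ.+ h) 1)
... | _ , suc (suc _) , s≤s () , _

theorem3p3 : ∀ (k t : ℕ) → 2 ℕDiv.∣ k → k ℕ.≥ 4 → ¬ (2 ℕDiv.∣ t) → t ℕ.≥ 3 →
    PartialFactorization (k ℕ.+ 1) t (k ℕ.* t)
theorem3p3 k t 2∣k k≥4 2∤t _
  with q , b , b≤1 , 1≤q+b , refl ← even≥4-split 2∣k k≥4
     | h , refl ← odd-split 2∤t
  = subst (λ n → PartialFactorization n (C.t) (C.k ℕ.* C.t)) (ℕₚ.+-comm 1 C.k) C.factorization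
  where module C = ExplicitStarter q b h b≤1 1≤q+b
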